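{- Let $d\ge1$ be an integer. Let $\mathcal{H}_d$ be the family of all graphs $X_{h,q}$ and $X_{\widetilde h,q}$, where $q$ ranges over odd prime powers, $h(x,y)=f(g(x),g(y))$ and $\widetilde h(x,y)=g(x)g(y)f(g(x),g(y))$, with $f\in\mathbb{F}_q[x,y]$ an admissible polynomial whose degree in $x$ and whose degree in $y$ are both $1$, and $g\in\mathbb{F}_q[x]$ a polynomial of degree $d$. Then $\mathcal{H}_d$ is a family of quasi-random graphs with property $QR(1/2)$: there is $c>0$ such that for every graph in $\mathcal{H}_d$ (with vertex set $\mathbb{F}_q$) and all $S,T\subset\mathbb{F}_q$, $\left|e(S,T)-\frac{|S||T|}{2}\right|\le c\,q^{1/2}\sqrt{|S||T|}$.
   Context: $q$ is an odd prime power; an element of $\mathbb{F}_q$ is a square if it equals $z^2$ for some $z\in\mathbb{F}_q$ (so $0$ is a square). For $f\in\mathbb{F}_q[x,y]$, $X_{f,q}$ is the simple graph with vertex set $\mathbb{F}_q$ in which distinct $a,b$ are adjacent iff $f(a,b)$ is a square. Every $f$ can be written $f=F(x)G(y)H(x,y)$ with $H$ primitive in both $x$ and $y$ (no nonconstant factor lying in $\mathbb{F}_q[x]$ or $\mathbb{F}_q[y]$); $H$ is the primitive kernel. $f$ is admissible if (i) for all $u,v\in\mathbb{F}_q$, $f(u,v)$ is a square iff $f(v,u)$ is a square, and (ii) $H$ is not a constant multiple of the square of a polynomial. $e(S,T)$ is the number of pairs $(s,t)\in S\times T$ with $s,t$ adjacent. A family of graphs with unbounded numbers of vertices has property $QR(\theta)$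 if there is $c>0$ with $|e(S,T)-|S||T|/2|\le c n^\theta\sqrt{|S||T|}$ for all graphs in it ($n$ = number of vertices) and all vertex subsets $S,T$. -}

module Defs where

open import Level using (0ℓ)
open import Data.Nat as ℕ using (ℕ; zero; suc)
open import Data.Fin as Fin using (Fin)
open import Data.Fin.Subset using (Subset; _∈_)
open import Data.Product using (Σ; ∃; _×_; _,_)
open import Data.Sum using (_⊎_)
open import Data.Bool using (Bool; true; false; if_then_else_)
open import Data.List using (List; filter; length; allFin; cartesianProduct)
open import Relation.Binary.PropositionalEquality using (_≡_)
open import Relation.Nullary using (¬_; Dec; yes; no; does)
open import Algebra.Structures using (IsCommutativeRing)
open import Function.Bundles using (_⇔_)

-- A finite field of order q, with carrier Fin q and propositional
-- equality.  Every finite field of order q is isomorphic to one of these.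

record FiniteField (q : ℕ) : Set where
  field
    _+_ _*_ : Fin q → Fin q → Fin q
    -_      : Fin q → Fin q
    0# 1#   : Fin q
    isCommutativeRing : IsCommutativeRing _≡_ _+_ _*_ -_ 0# 1#
    0≢1     : ¬ (0# ≡ 1#)
    inverse : (a : Fin q) → ¬ (a ≡ 0#) → ∃ λ b → a * b ≡ 1#

module FF {q : ℕ} (𝔽 : FiniteField q) where
  open FiniteField 𝔽 public

  sumTo : ℕ → (ℕ → Fin q) → Fin q
  sumTo zero    f = f 0
  sumTo (suc n) f = sumTo n f + f (suc n)

  _^_ : Fin q → ℕ → Fin q
  a ^ zero  = 1#
  a ^ suc n = a * (a ^ n)

  -- an element is a square if it equals z² for some z (so 0 is a square)
  IsSquare : Fin q → Set
  IsSquare a = ∃ λ z → z * z ≡ a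

  record Poly : Set where
    field
      coeff : ℕ → Fin q
      bound : ℕ
      vanish : ∀ i → bound ℕ.< i → coeff i ≡ 0#

  evalP : Poly → Fin q → Fin q
  evalP g u = sumTo (Poly.bound g) (λ i → Poly.coeff g i * (u ^ i))

  HasDegree : Poly → ℕ → Set
  HasDegree g d = ¬ (Poly.coeff g d ≡ 0#) × (∀ i → d ℕ.< i → Poly.coeff g i ≡ 0#)

  -- Bivariate polynomials: coeff i j is the coefficient of x^i y^j.
  record Poly2 : Set where
    field
      coeff : ℕ → ℕ → Fin q
      bound : ℕ
      vanish : ∀ i j → (bound ℕ.< i ⊎ bound ℕ.< j) → coeff i j ≡ 0#

  open Poly2

  _≈P_ : Poly2 → Poly2 → Set
  P ≈P Q = ∀ i j → coeff P i j ≡ coeff Q i j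

  mulCoeff : Poly2 → Poly2 → ℕ → ℕ → Fin q
  mulCoeff P Q i j =
    sumTo i (λ k → sumTo j (λ l → coeff P k l * coeff Q (i ℕ.∸ k) (j ℕ.∸ l)))

  IsProduct : Poly2 → Poly2 → Poly2 → Set
  IsProduct R P Q = ∀ i j → coeff R i j ≡ mulCoeff P Q i j

  IsProduct3 : Poly2 → Poly2 → Poly2 → Poly2 → Set
  IsProduct3 R P Q S = ∃ λ PQ → IsProduct PQ P Q × IsProduct R PQ S

  evalP2 : Poly2 → Fin q → Fin q → Fin q
  evalP2 P u v = sumTo (bound P) (λ i → sumTo (bound P) (λ j →
                   coeff P i j * ((u ^ i) * (v ^ j))))

  InX : Poly2 → Set
  InX P = ∀ i j → 0 ℕ.< j → coeff P i j ≡ 0#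

  InY : Poly2 → Set
  InY P = ∀ i j → 0 ℕ.< i → coeff P i j ≡ 0#

  NonConstant : Poly2 → Set
  NonConstant P = ∃ λ i → ∃ λ j → (0 ℕ.< i ⊎ 0 ℕ.< j) × ¬ (coeff P i j ≡ 0#)

  Divides : Poly2 → Poly2 → Set
  Divides P R = ∃ λ Q → IsProduct R P Q

  Primitive : Poly2 → Set
  Primitive H = ∀ P → (InX P ⊎ InY P) → NonConstant P → ¬ Divides P H

  PrimitiveKernel : Poly2 → Poly2 → Set
  PrimitiveKernel f H = ∃ λ F → ∃ λ G → InX F × InY G × IsProduct3 f F G H × Primitive H

  ConstTimesSquare : Poly2 → Set
  ConstTimesSquare H = ∃ λ c → ∃ λ K → ∀ i j → coeff H i j ≡ c * mulCoeff K K i j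

  Admissible : Poly2 → Set
  Admissible f =
    (∀ u v → IsSquare (evalP2 f u v) ⇔ IsSquare (evalP2 f v u))
    × (∀ H → PrimitiveKernel f H → ¬ ConstTimesSquare H)

  DegX1 : Poly2 → Set
  DegX1 f = (∀ i j → 1 ℕ.< i → coeff f i j ≡ 0#) × ∃ λ j → ¬ (coeff f 1 j ≡ 0#)

  DegY1 : Poly2 → Set
  DegY1 f = (∀ i j → 1 ℕ.< j → coeff f i j ≡ 0#) × ∃ λ i → ¬ (coeff f i 1 ≡ 0#)

  isSquare? : (a : Fin q) → Dec (IsSquare a)
  isSquare? a = Data.Fin.Properties.any? (λ z → z * z Fin.≟ a)
    where import Data.Fin.Properties

module Graph {q : ℕ} (𝔽 : FiniteField q) (w : Fin q → Fin q → Fin q) where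
  open FF 𝔽

  adjacent? : Fin q → Fin q → Bool
  adjacent? a b with a Fin.≟ b
  ... | yes _ = false
  ... | no  _ = does (isSquare? (w a b))

  e : Subset q → Subset q → ℕ
  e S T = length (filter (λ p → inPair p) (cartesianProduct (allFin q) (allFin q)))
    where
      open import Data.Fin.Subset.Properties using (_∈?_)
      open import Relation.Nullary.Decidable using (_×-dec_; True)
      open import Data.Bool.Properties using (T?)
      inPair : (p : Fin q × Fin q) → Dec _
      inPair (s , t) = (s ∈? S) ×-dec ((t ∈? T) ×-dec T? (adjacent? s t))

module _ {q : ℕ} (𝔽 : FiniteField q) where
  open FF 𝔽
  hFun : Poly2 → Poly → Fin q → Fin q → Fin q
  hFun f g a b = evalP2 f (evalP g a) (evalP g b)

  h~Fun : Poly2 → Poly → Fin q → Fin q → Fin q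
  h~Fun f g a b = (evalP g a * evalP g b) * evalP2 f (evalP g a) (evalP g b)

module Submission where

-- With χ the quadratic character and w = h or h̃, 2 [w is a square] - 1 = χ (w) + [w = 0] off the diagonal, so
-- 2 e(S,T) - |S| |T| splits into a character sum over S × T, a count of zeros of w, and a diagonal term.
-- Admissibility and bidegree (1,1) force f = a x y + b x + c y + e with a e ≠ b c. For v₁ ≠ v₂ the sum
-- ∑ᵤ χ (f (u, v₁)) χ (f (u, v₂)) is then a Jacobi sum of two non-proportional linear forms, of absolute
-- value at most 1, and Cauchy–Schwarz bounds the square of the character sum by 2 q ‖α‖² ‖β‖², where
-- α u and β u count the points of S and T in the fibre of g over u. Fibres of g have at most d points,
-- so ‖α‖² ≤ d |S| and ‖β‖² ≤ d |T|; the zeros and the diagonal are bounded by counting roots.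

open import Defs
open import Data.Nat as ℕ using (ℕ)
open import Relation.Binary.PropositionalEquality using (_≡_)
open import Algebra.Structures using (IsCommutativeRing)

module IntegerSums where

  open import Data.Nat as ℕ using (ℕ; zero; suc)
  open import Data.Fin as Fin using (Fin; zero; suc)
  import Data.Fin.Properties as FinP
  import Data.Nat.Properties as ℕP
  open import Data.Fin.Permutation using (permutation)
  open import Data.Integer as ℤ using (ℤ; +_; _+_; _*_; -_; _-_; _≤_; 0ℤ; 1ℤ; +≤+; _⊖_)
  import Data.Integer.Properties as ℤP
  open import Data.Integer.Tactic.RingSolver using (solve-∀)
  import Algebra.Properties.Semiring.Sum as SemiringSum
  open import Relation.Binary.PropositionalEquality
  open import Relation.Nullary using (Dec; yes; no; ¬_; does)
  open import Data.Bool.Properties using (T?)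
  open import Data.Empty using (⊥-elim)
  open import Data.Sum using (_⊎_; inj₁; inj₂)
  open import Data.Nat.DivMod using (_%_; m*n%n≡0)
  open import Function using (_∘_; id)
  open import Relation.Nullary.Decidable using (_⊎-dec_)

  𝟙 : ∀ {a} {P : Set a} → Dec P → ℤ
  𝟙 (yes _) = 1ℤ
  𝟙 (no _)  = 0ℤ

  𝟙-yes : ∀ {a} {P : Set a} (p? : Dec P) → P → 𝟙 p? ≡ 1ℤ
  𝟙-yes (yes _) _ = refl
  𝟙-yes (no ¬p) p = ⊥-elim (¬p p)

  𝟙-no : ∀ {a} {P : Set a} (p? : Dec P) → ¬ P → 𝟙 p? ≡ 0ℤ
  𝟙-no (yes p) ¬p = ⊥-elim (¬p p)
  𝟙-no (no _)  _  = refl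

  𝟙-nonneg : ∀ {a} {P : Set a} (p? : Dec P) → 0ℤ ≤ 𝟙 p?
  𝟙-nonneg (yes _) = +≤+ ℕ.z≤n
  𝟙-nonneg (no _)  = +≤+ ℕ.z≤n

  𝟙-≤1 : ∀ {a} {P : Set a} (p? : Dec P) → 𝟙 p? ≤ 1ℤ
  𝟙-≤1 (yes _) = ℤP.≤-refl
  𝟙-≤1 (no _)  = +≤+ ℕ.z≤n

  𝟙-mono : ∀ {a b} {P : Set a} {Q : Set b} (p? : Dec P) (q? : Dec Q) → (P → Q) → 𝟙 p? ≤ 𝟙 q?
  𝟙-mono (yes p) q? f = ℤP.≤-reflexive (sym (𝟙-yes q? (f p)))
  𝟙-mono (no _)  q? f = 𝟙-nonneg q?

  𝟙-cong : ∀ {a b} {P : Set a} {Q : Set b} (p? : Dec P) (q? : Dec Q) → (P → Q) → (Q → P) → 𝟙 p? ≡ 𝟙 q?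
  𝟙-cong p? q? f g = ℤP.≤-antisym (𝟙-mono p? q? f) (𝟙-mono q? p? g)

  𝟙-T?-does : ∀ {a} {P : Set a} (p? : Dec P) → 𝟙 (T? (does p?)) ≡ 𝟙 p?
  𝟙-T?-does (yes _) = refl
  𝟙-T?-does (no _)  = refl

  𝟙-⊎ : ∀ {a b c} {P : Set a} {Q : Set b} {R : Set c} (p? : Dec P) (q? : Dec Q) (r? : Dec R) →
        (P → Q ⊎ R) → 𝟙 p? ≤ 𝟙 q? + 𝟙 r?
  𝟙-⊎ (no _) q? r? _ = ℤP.+-mono-≤ (𝟙-nonneg q?) (𝟙-nonneg r?)
  𝟙-⊎ (yes p) q? r? p⇒q⊎r with p⇒q⊎r p
  ... | inj₁ q = subst₂ _≤_ (ℤP.+-identityʳ 1ℤ) (cong (_+ 𝟙 r?) (sym (𝟙-yes q? q))) (ℤP.+-monoʳ-≤ 1ℤ (𝟙-nonneg r?))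
  ... | inj₂ r = subst₂ _≤_ (ℤP.+-identityˡ 1ℤ) (cong (_+_ (𝟙 q?)) (sym (𝟙-yes r? r))) (ℤP.+-monoˡ-≤ 1ℤ (𝟙-nonneg q?))

  𝟙-⊎₃ : ∀ {a b c e} {P : Set a} {Q : Set b} {R : Set c} {S : Set e}
          (p? : Dec P) (q? : Dec Q) (r? : Dec R) (s? : Dec S) → (P → Q ⊎ R ⊎ S) → 𝟙 p? ≤ 𝟙 q? + 𝟙 r? + 𝟙 s?
  𝟙-⊎₃ p? q? r? s? p⇒q⊎r⊎s = begin
    𝟙 p?                        ≤⟨ 𝟙-⊎ p? q? (r? ⊎-dec s?) p⇒q⊎r⊎s ⟩
    𝟙 q? + 𝟙 (r? ⊎-dec s?)      ≤⟨ ℤP.+-monoʳ-≤ (𝟙 q?) (𝟙-⊎ (r? ⊎-dec s?) r? s? id) ⟩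
    𝟙 q? + (𝟙 r? + 𝟙 s?)        ≡⟨ ℤP.+-assoc (𝟙 q?) (𝟙 r?) (𝟙 s?) ⟨
    𝟙 q? + 𝟙 r? + 𝟙 s?          ∎
    where open ℤP.≤-Reasoning

  private module S = SemiringSum ℤP.+-*-semiring

  opaque
    ∑ : ∀ {n} → (Fin n → ℤ) → ℤ
    ∑ = S.sum

    ∑-zero : (f : Fin 0 → ℤ) → ∑ f ≡ 0ℤ
    ∑-zero f = refl

    ∑-suc : ∀ {n} (f : Fin (suc n) → ℤ) → ∑ f ≡ f zero + ∑ (f ∘ suc)
    ∑-suc f = refl

    ∑-cong : ∀ {n} {f g : Fin n → ℤ} → (∀ x → f x ≡ g x) → ∑ f ≡ ∑ g
    ∑-cong = S.sum-cong-≗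

    ∑-+ : ∀ {n} (f g : Fin n → ℤ) → ∑ (λ x → f x + g x) ≡ ∑ f + ∑ g
    ∑-+ = S.∑-distrib-+

    ∑-comm : ∀ {m n} (f : Fin m → Fin n → ℤ) → ∑ (λ i → ∑ (f i)) ≡ ∑ (λ j → ∑ (λ i → f i j))
    ∑-comm = S.∑-comm

    ∑-*ˡ : ∀ {n} (c : ℤ) (f : Fin n → ℤ) → ∑ (λ x → c * f x) ≡ c * ∑ f
    ∑-*ˡ c f = sym (S.*-distribˡ-sum c f)

    ∑-permute : ∀ {n} (π π⁻¹ : Fin n → Fin n) → (∀ x → π (π⁻¹ x) ≡ x) → (∀ x → π⁻¹ (π x) ≡ x) →
                (f : Fin n → ℤ) → ∑ (f ∘ π) ≡ ∑ f
    ∑-permute π π⁻¹ inv₁ inv₂ f = sym (S.∑-permute f (permutation π π⁻¹ inv₁ inv₂))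

  ∑-*ʳ : ∀ {n} (c : ℤ) (f : Fin n → ℤ) → ∑ (λ x → f x * c) ≡ ∑ f * c
  ∑-*ʳ c f = trans (∑-cong (λ x → ℤP.*-comm (f x) c)) (trans (∑-*ˡ c f) (ℤP.*-comm c (∑ f)))

  ∑-neg : ∀ {n} (f : Fin n → ℤ) → ∑ (λ x → - f x) ≡ - ∑ f
  ∑-neg f = trans (∑-cong (λ x → sym (ℤP.-1*i≡-i (f x)))) (trans (∑-*ˡ ℤ.-1ℤ f) (ℤP.-1*i≡-i (∑ f)))

  ∑-sub : ∀ {n} (f g : Fin n → ℤ) → ∑ (λ x → f x - g x) ≡ ∑ f - ∑ g
  ∑-sub f g = trans (∑-+ f (λ x → - g x)) (cong (_+_ (∑ f)) (∑-neg g))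

  ∑-const : ∀ {n} (c : ℤ) → ∑ {n} (λ _ → c) ≡ + n * c
  ∑-const {zero}  c = trans (∑-zero _) (sym (ℤP.*-zeroˡ c))
  ∑-const {suc n} c = begin
    ∑ {suc n} (λ _ → c)  ≡⟨ ∑-suc _ ⟩
    c + ∑ {n} (λ _ → c)  ≡⟨ cong (_+_ c) (∑-const c) ⟩
    c + + n * c          ≡⟨ cong (_+ + n * c) (sym (ℤP.*-identityˡ c)) ⟩
    1ℤ * c + + n * c     ≡⟨ ℤP.*-distribʳ-+ c 1ℤ (+ n) ⟨
    (1ℤ + + n) * c       ≡⟨ cong (_* c) (ℤP.pos-+ 1 n) ⟨
    + suc n * c          ∎
    where open ≡-Reasoning

  ∑-mono : ∀ {n} {f g : Fin n → ℤ} → (∀ x → f x ≤ g x) → ∑ f ≤ ∑ g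
  ∑-mono {zero}  {f} {g} _ = ℤP.≤-reflexive (trans (∑-zero f) (sym (∑-zero g)))
  ∑-mono {suc n} {f} {g} f≤g = subst₂ _≤_ (sym (∑-suc f)) (sym (∑-suc g))
    (ℤP.+-mono-≤ (f≤g zero) (∑-mono (f≤g ∘ suc)))

  ∑-0 : ∀ {n} → ∑ {n} (λ _ → 0ℤ) ≡ 0ℤ
  ∑-0 {n} = trans (∑-const 0ℤ) (ℤP.*-zeroʳ (+ n))

  ∑-nonneg : ∀ {n} {f : Fin n → ℤ} → (∀ x → 0ℤ ≤ f x) → 0ℤ ≤ ∑ f
  ∑-nonneg {n} 0≤f = ℤP.≤-trans (ℤP.≤-reflexive (sym (trans (∑-const {n} 0ℤ) (ℤP.*-zeroʳ (+ n))))) (∑-mono 0≤f)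

  ∑-δ : ∀ {n} (a : Fin n) (f : Fin n → ℤ) → ∑ (λ x → 𝟙 (x Fin.≟ a) * f x) ≡ f a
  ∑-δ {suc n} zero f = begin
    ∑ (λ x → 𝟙 (x Fin.≟ zero) * f x)                ≡⟨ ∑-suc _ ⟩
    1ℤ * f zero + ∑ (λ x → 𝟙 (suc x Fin.≟ zero) * f (suc x))
      ≡⟨ cong₂ _+_ (ℤP.*-identityˡ (f zero)) (∑-cong (λ x → ℤP.*-zeroˡ (f (suc x)))) ⟩
    f zero + ∑ {n} (λ _ → 0ℤ)                         ≡⟨ cong (_+_ (f zero)) (trans (∑-const 0ℤ) (ℤP.*-zeroʳ (+ n))) ⟩
    f zero + 0ℤ                                       ≡⟨ ℤP.+-identityʳ (f zero) ⟩
    f zero                                            ∎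
    where open ≡-Reasoning
  ∑-δ {suc n} (suc a) f = begin
    ∑ (λ x → 𝟙 (x Fin.≟ suc a) * f x)                 ≡⟨ ∑-suc _ ⟩
    0ℤ * f zero + ∑ (λ x → 𝟙 (suc x Fin.≟ suc a) * f (suc x))
      ≡⟨ trans (cong (_+ rest) (ℤP.*-zeroˡ (f zero))) (ℤP.+-identityˡ rest) ⟩
    ∑ (λ x → 𝟙 (suc x Fin.≟ suc a) * f (suc x))       ≡⟨ ∑-cong (λ x → cong (_* f (suc x)) (𝟙-cong (suc x Fin.≟ suc a) (x Fin.≟ a) FinP.suc-injective (cong suc))) ⟩
    ∑ (λ x → 𝟙 (x Fin.≟ a) * f (suc x))               ≡⟨ ∑-δ a (f ∘ suc) ⟩
    f (suc a)                                         ∎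
    where
    open ≡-Reasoning
    rest = ∑ (λ x → 𝟙 (suc x Fin.≟ suc a) * f (suc x))

  ∑-𝟙≡ : ∀ {n} (a : Fin n) → ∑ (λ x → 𝟙 (x Fin.≟ a)) ≡ 1ℤ
  ∑-𝟙≡ a = trans (∑-cong (λ x → sym (ℤP.*-identityʳ _))) (∑-δ a (λ _ → 1ℤ))

  ∑-product : ∀ {m n} (f : Fin m → ℤ) (g : Fin n → ℤ) → ∑ (λ x → ∑ (λ y → f x * g y)) ≡ ∑ f * ∑ g
  ∑-product f g = trans (∑-cong (λ x → ∑-*ˡ (f x) g)) (∑-*ʳ (∑ g) f)

  ∑-≤-each : ∀ {n} (f : Fin n → ℤ) → (∀ x → f x ≤ 0ℤ) → ∀ a → ∑ f ≤ f a
  ∑-≤-each {suc n} f f≤0 zero = begin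
    ∑ f                 ≡⟨ ∑-suc f ⟩
    f zero + ∑ (f ∘ suc) ≤⟨ ℤP.+-monoʳ-≤ (f zero) (ℤP.≤-trans (∑-mono (f≤0 ∘ suc)) (ℤP.≤-reflexive (trans (∑-const 0ℤ) (ℤP.*-zeroʳ (+ n))))) ⟩
    f zero + 0ℤ          ≡⟨ ℤP.+-identityʳ (f zero) ⟩
    f zero               ∎
    where open ℤP.≤-Reasoning
  ∑-≤-each {suc n} f f≤0 (suc a) = begin
    ∑ f                  ≡⟨ ∑-suc f ⟩
    f zero + ∑ (f ∘ suc) ≤⟨ ℤP.+-monoˡ-≤ (∑ (f ∘ suc)) (f≤0 zero) ⟩
    0ℤ + ∑ (f ∘ suc)     ≡⟨ ℤP.+-identityˡ _ ⟩
    ∑ (f ∘ suc)          ≤⟨ ∑-≤-each (f ∘ suc) (f≤0 ∘ suc) a ⟩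
    f (suc a)            ∎
    where open ℤP.≤-Reasoning

  nonpos-∑≡0⇒≡0 : ∀ {n} (f : Fin n → ℤ) → (∀ x → f x ≤ 0ℤ) → ∑ f ≡ 0ℤ → ∀ a → f a ≡ 0ℤ
  nonpos-∑≡0⇒≡0 f f≤0 ∑f≡0 a = ℤP.≤-antisym (f≤0 a) (subst (_≤ f a) ∑f≡0 (∑-≤-each f f≤0 a))

  -- Pair each x with τ x and count, in each pair, the member that comes first.
  fixedPointFree-involution⇒even : ∀ {n} (τ : Fin n → Fin n) → (∀ x → τ (τ x) ≡ x) → (∀ x → τ x ≢ x) → n % 2 ≡ 0
  fixedPointFree-involution⇒even {n} τ ττ≡id τ≢id = halves (∑ first) n≡2∑first
    where
    first : Fin _ → ℤ
    first x = 𝟙 (Fin.toℕ x ℕ.<? Fin.toℕ (τ x))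
    one-of-pair : ∀ x → first x + first (τ x) ≡ 1ℤ
    one-of-pair x with Fin.toℕ x ℕ.<? Fin.toℕ (τ x) | Fin.toℕ (τ x) ℕ.<? Fin.toℕ (τ (τ x))
    ... | yes x<τx | yes τx<ττx = ⊥-elim (ℕP.<-asym x<τx (subst (Fin.toℕ (τ x) ℕ.<_) (cong Fin.toℕ (ττ≡id x)) τx<ττx))
    ... | yes _    | no _       = refl
    ... | no _     | yes _      = refl
    ... | no x≮τx  | no τx≮ττx  = ⊥-elim (τ≢id x (FinP.toℕ-injective (ℕP.≤-antisym
                                     (ℕP.≮⇒≥ x≮τx) (subst (ℕ._≤ Fin.toℕ (τ x)) (cong Fin.toℕ (ττ≡id x)) (ℕP.≮⇒≥ τx≮ττx)))))
    n≡2∑first : + n ≡ ∑ first + ∑ first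
    n≡2∑first = begin
      + n                             ≡⟨ ℤP.*-identityʳ (+ n) ⟨
      + n * 1ℤ                        ≡⟨ ∑-const 1ℤ ⟨
      ∑ (λ _ → 1ℤ)                    ≡⟨ ∑-cong one-of-pair ⟨
      ∑ (λ x → first x + first (τ x)) ≡⟨ ∑-+ first (first ∘ τ) ⟩
      ∑ first + ∑ (first ∘ τ)         ≡⟨ cong (_+_ (∑ first)) (∑-permute τ τ ττ≡id ττ≡id first) ⟩
      ∑ first + ∑ first               ∎
      where open ≡-Reasoning
    halves : ∀ z → + n ≡ z + z → n % 2 ≡ 0
    halves (+ k) n≡k+k = trans (cong (_% 2) (trans (ℤP.+-injective n≡k+k) (cong (k ℕ.+_) (sym (ℕP.+-identityʳ k))))) (trans (cong (_% 2) (ℕP.*-comm 2 k)) (m*n%n≡0 k 2))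

  sq : ℤ → ℤ
  sq x = x * x

  sq-nonneg : ∀ x → 0ℤ ≤ sq x
  sq-nonneg (+ n)      = subst (0ℤ ≤_) (ℤP.pos-* n n) (+≤+ ℕ.z≤n)
  sq-nonneg ℤ.-[1+ n ] = subst (0ℤ ≤_) (trans (ℤP.pos-* (suc n) (suc n)) (ℤP.neg-distribʳ-* ℤ.-[1+ n ] (+ suc n))) (+≤+ ℕ.z≤n)

  *-nonneg : ∀ {a b} → 0ℤ ≤ a → 0ℤ ≤ b → 0ℤ ≤ a * b
  *-nonneg {a} {b} 0≤a 0≤b = ℤP.≤-trans (ℤP.≤-reflexive (sym (ℤP.*-zeroˡ b))) (ℤP.*-monoʳ-≤-nonNeg b {{ℤ.nonNegative 0≤b}} 0≤a)

  *-monoˡ-≤-0≤ : ∀ c {a b} → 0ℤ ≤ c → a ≤ b → c * a ≤ c * b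
  *-monoˡ-≤-0≤ c 0≤c = ℤP.*-monoˡ-≤-nonNeg c {{ℤ.nonNegative 0≤c}}

  *-monoʳ-≤-0≤ : ∀ c {a b} → 0ℤ ≤ c → a ≤ b → a * c ≤ b * c
  *-monoʳ-≤-0≤ c 0≤c = ℤP.*-monoʳ-≤-nonNeg c {{ℤ.nonNegative 0≤c}}

  *-mono-≤-0≤ : ∀ {a b c d} → 0ℤ ≤ a → 0ℤ ≤ c → a ≤ b → c ≤ d → a * c ≤ b * d
  *-mono-≤-0≤ {b = b} {c} 0≤a 0≤c a≤b c≤d =
    ℤP.≤-trans (*-monoʳ-≤-0≤ c 0≤c a≤b) (*-monoˡ-≤-0≤ b (ℤP.≤-trans 0≤a a≤b) c≤d)

  i≤+∣i∣ : ∀ i → i ≤ + ℤ.∣ i ∣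
  i≤+∣i∣ (+ n)      = ℤP.≤-refl
  i≤+∣i∣ ℤ.-[1+ n ] = ℤ.-≤+

  i*j≤∣i∣ : ∀ i j → ℤ.∣ j ∣ ℕ.≤ 1 → i * j ≤ + ℤ.∣ i ∣
  i*j≤∣i∣ i j ∣j∣≤1 = ℤP.≤-trans (i≤+∣i∣ (i * j)) (+≤+ (begin
    ℤ.∣ i * j ∣            ≡⟨ ℤP.abs-* i j ⟩
    ℤ.∣ i ∣ ℕ.* ℤ.∣ j ∣    ≤⟨ ℕP.*-monoʳ-≤ ℤ.∣ i ∣ ∣j∣≤1 ⟩
    ℤ.∣ i ∣ ℕ.* 1          ≡⟨ ℕP.*-identityʳ ℤ.∣ i ∣ ⟩
    ℤ.∣ i ∣                ∎))
    where open ℕP.≤-Reasoning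

  sq-neg : ∀ i → sq (- i) ≡ sq i
  sq-neg i = trans (sym (ℤP.neg-distribˡ-* i (- i))) (trans (cong -_ (sym (ℤP.neg-distribʳ-* i i))) (ℤP.neg-involutive (i * i)))

  ∣i∣≤1⇒sq≤1 : ∀ i → ℤ.∣ i ∣ ℕ.≤ 1 → sq i ≤ 1ℤ
  ∣i∣≤1⇒sq≤1 i ∣i∣≤1 = ℤP.≤-trans (i*j≤∣i∣ i i ∣i∣≤1) (+≤+ ∣i∣≤1)

  sq-∣∣ : ∀ i → sq (+ ℤ.∣ i ∣) ≡ sq i
  sq-∣∣ i = begin
    + ℤ.∣ i ∣ * + ℤ.∣ i ∣     ≡⟨ ℤP.pos-* ℤ.∣ i ∣ ℤ.∣ i ∣ ⟨
    + (ℤ.∣ i ∣ ℕ.* ℤ.∣ i ∣)   ≡⟨ cong +_ (ℤP.abs-* i i) ⟨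
    + ℤ.∣ i * i ∣             ≡⟨ ℤP.0≤i⇒+∣i∣≡i (sq-nonneg i) ⟩
    i * i                     ∎
    where open ≡-Reasoning

  sq≤* : ∀ {y a b} → 0ℤ ≤ y → y ≤ a → y ≤ b → sq y ≤ a * b
  sq≤* 0≤y y≤a y≤b = *-mono-≤-0≤ 0≤y 0≤y y≤a y≤b

  sq-+₃≤ : ∀ x y z → sq (x + y + z) ≤ + 3 * (sq x + sq y + sq z)
  sq-+₃≤ x y z = ℤP.0≤i-j⇒j≤i (ℤP.≤-trans
    (ℤP.+-mono-≤ (ℤP.+-mono-≤ (sq-nonneg (x - y)) (sq-nonneg (y - z))) (sq-nonneg (x - z)))
    (ℤP.≤-reflexive (identity x y z)))
    where
    identity : ∀ x y z → (x - y) * (x - y) + (y - z) * (y - z) + (x - z) * (x - z)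
                         ≡ + 3 * (x * x + y * y + z * z) - (x + y + z) * (x + y + z)
    identity = solve-∀

  sq-+₃≤-multiples : ∀ {Q} x y z i j k → sq x ≤ + i * Q → sq y ≤ + j * Q → sq z ≤ + k * Q →
                     sq (x + y + z) ≤ + (3 ℕ.* (i ℕ.+ j ℕ.+ k)) * Q
  sq-+₃≤-multiples {Q} x y z i j k x² y² z² = begin
    sq (x + y + z)                          ≤⟨ sq-+₃≤ x y z ⟩
    + 3 * (sq x + sq y + sq z)              ≤⟨ *-monoˡ-≤-0≤ (+ 3) (+≤+ ℕ.z≤n) (ℤP.+-mono-≤ (ℤP.+-mono-≤ x² y²) z²) ⟩
    + 3 * (+ i * Q + + j * Q + + k * Q)      ≡⟨ collect (+ 3) (+ i) (+ j) (+ k) Q ⟩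
    + 3 * (+ i + + j + + k) * Q              ≡⟨ cong (λ t → + 3 * t * Q) (trans (cong (_+ + k) (ℤP.pos-+ i j)) (ℤP.pos-+ (i ℕ.+ j) k)) ⟨
    + 3 * + (i ℕ.+ j ℕ.+ k) * Q              ≡⟨ cong (_* Q) (ℤP.pos-* 3 (i ℕ.+ j ℕ.+ k)) ⟨
    + (3 ℕ.* (i ℕ.+ j ℕ.+ k)) * Q            ∎
    where
    open ℤP.≤-Reasoning
    collect : ∀ c i j k Q → c * (i * Q + j * Q + k * Q) ≡ c * (i + j + k) * Q
    collect = solve-∀

  ∣⊖∣≡∣-∣ : ∀ m n → ℤ.∣ m ⊖ n ∣ ≡ ℕ.∣ m - n ∣
  ∣⊖∣≡∣-∣ zero    zero    = refl
  ∣⊖∣≡∣-∣ zero    (suc n) = refl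
  ∣⊖∣≡∣-∣ (suc m) zero    = refl
  ∣⊖∣≡∣-∣ (suc m) (suc n) = trans (cong ℤ.∣_∣ (ℤP.[1+m]⊖[1+n]≡m⊖n m n)) (∣⊖∣≡∣-∣ m n)

  integer-bound⇒ℕ : ∀ m s t C q → sq (+ m ℤ.- + s ℤ.* + t) ℤ.≤ + C ℤ.* (+ q ℤ.* (+ s ℤ.* + t)) →
                    ℕ.∣ m - s ℕ.* t ∣ ℕ.^ 2 ℕ.≤ C ℕ.* q ℕ.* s ℕ.* t
  integer-bound⇒ℕ m s t C q bound = ℤP.drop‿+≤+ (subst₂ ℤ._≤_ lhs rhs bound)
    where
    D = + m ℤ.- + s ℤ.* + t
    ∣D∣≡ : ℤ.∣ D ∣ ≡ ℕ.∣ m - s ℕ.* t ∣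
    ∣D∣≡ = trans (cong (λ x → ℤ.∣ + m ℤ.- x ∣) (sym (ℤP.pos-* s t))) (trans (cong ℤ.∣_∣ (ℤP.m-n≡m⊖n m (s ℕ.* t))) (∣⊖∣≡∣-∣ m (s ℕ.* t)))
    open ≡-Reasoning
    x = ℕ.∣ m - s ℕ.* t ∣
    lhs : sq D ≡ + (x ℕ.^ 2)
    lhs = begin
      sq D                          ≡⟨ sq-∣∣ D ⟨
      + ℤ.∣ D ∣ ℤ.* + ℤ.∣ D ∣       ≡⟨ ℤP.pos-* ℤ.∣ D ∣ ℤ.∣ D ∣ ⟨
      + (ℤ.∣ D ∣ ℕ.* ℤ.∣ D ∣)       ≡⟨ cong (λ k → + (k ℕ.* k)) ∣D∣≡ ⟩
      + (x ℕ.* x)                   ≡⟨ cong (λ k → + (x ℕ.* k)) (ℕP.*-identityʳ x) ⟨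
      + (x ℕ.^ 2)                   ∎
    rhs : + C ℤ.* (+ q ℤ.* (+ s ℤ.* + t)) ≡ + (C ℕ.* q ℕ.* s ℕ.* t)
    rhs = begin
      + C ℤ.* (+ q ℤ.* (+ s ℤ.* + t))    ≡⟨ reassociate (+ C) (+ q) (+ s) (+ t) ⟩
      ((+ C ℤ.* + q) ℤ.* + s) ℤ.* + t    ≡⟨ cong (λ k → (k ℤ.* + s) ℤ.* + t) (ℤP.pos-* C q) ⟨
      (+ (C ℕ.* q) ℤ.* + s) ℤ.* + t      ≡⟨ cong (ℤ._* + t) (ℤP.pos-* (C ℕ.* q) s) ⟨
      + (C ℕ.* q ℕ.* s) ℤ.* + t          ≡⟨ ℤP.pos-* (C ℕ.* q ℕ.* s) t ⟨
      + (C ℕ.* q ℕ.* s ℕ.* t)            ∎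
      where
      reassociate : ∀ a b c e → a ℤ.* (b ℤ.* (c ℤ.* e)) ≡ ((a ℤ.* b) ℤ.* c) ℤ.* e
      reassociate = solve-∀

  lagrange-identity : ∀ {n} (a b : Fin n → ℤ) →
    ∑ (λ x → ∑ (λ y → sq (a x * b y - a y * b x))) ≡ + 2 * (∑ (sq ∘ a) * ∑ (sq ∘ b) - sq (∑ (λ x → a x * b x)))
  lagrange-identity a b = begin
    ∑ (λ x → ∑ (λ y → sq (a x * b y - a y * b x)))
      ≡⟨ ∑-cong (λ x → ∑-cong (λ y → expand (a x) (b x) (a y) (b y))) ⟩
    ∑ (λ x → ∑ (λ y → (sq (a x) * sq (b y) + sq (a y) * sq (b x)) - + 2 * ((a x * b x) * (a y * b y))))
      ≡⟨ ∑-cong (λ x → ∑-sub _ _) ⟩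
    ∑ (λ x → ∑ (λ y → sq (a x) * sq (b y) + sq (a y) * sq (b x)) - ∑ (λ y → + 2 * ((a x * b x) * (a y * b y))))
      ≡⟨ ∑-sub _ _ ⟩
    ∑ (λ x → ∑ (λ y → sq (a x) * sq (b y) + sq (a y) * sq (b x))) - ∑ (λ x → ∑ (λ y → + 2 * ((a x * b x) * (a y * b y))))
      ≡⟨ cong₂ _-_ squares cross ⟩
    (A * B + A * B) - + 2 * (C * C)
      ≡⟨ double A B C ⟩
    + 2 * (A * B - sq C) ∎
    where
    open ≡-Reasoning
    A = ∑ (sq ∘ a)
    B = ∑ (sq ∘ b)
    C = ∑ (λ x → a x * b x)
    double : ∀ A B C → (A * B + A * B) - + 2 * (C * C) ≡ + 2 * (A * B - C * C)
    double = solve-∀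
    expand : ∀ w x y z → (w * z - y * x) * (w * z - y * x) ≡ ((w * w) * (z * z) + (y * y) * (x * x)) - + 2 * ((w * x) * (y * z))
    expand = solve-∀
    squares : ∑ (λ x → ∑ (λ y → sq (a x) * sq (b y) + sq (a y) * sq (b x))) ≡ A * B + A * B
    squares = begin
      ∑ (λ x → ∑ (λ y → sq (a x) * sq (b y) + sq (a y) * sq (b x)))
        ≡⟨ ∑-cong (λ x → ∑-+ _ _) ⟩
      ∑ (λ x → ∑ (λ y → sq (a x) * sq (b y)) + ∑ (λ y → sq (a y) * sq (b x)))
        ≡⟨ ∑-+ _ _ ⟩
      ∑ (λ x → ∑ (λ y → sq (a x) * sq (b y))) + ∑ (λ x → ∑ (λ y → sq (a y) * sq (b x)))
        ≡⟨ cong₂ _+_ (∑-product (sq ∘ a) (sq ∘ b)) (trans (∑-comm _) (∑-product (sq ∘ a) (sq ∘ b))) ⟩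
      A * B + A * B ∎
    cross : ∑ (λ x → ∑ (λ y → + 2 * ((a x * b x) * (a y * b y)))) ≡ + 2 * (C * C)
    cross = begin
      ∑ (λ x → ∑ (λ y → + 2 * ((a x * b x) * (a y * b y))))
        ≡⟨ ∑-cong (λ x → ∑-*ˡ (+ 2) _) ⟩
      ∑ (λ x → + 2 * ∑ (λ y → (a x * b x) * (a y * b y)))
        ≡⟨ ∑-*ˡ (+ 2) _ ⟩
      + 2 * ∑ (λ x → ∑ (λ y → (a x * b x) * (a y * b y)))
        ≡⟨ cong (+ 2 *_) (∑-product (λ x → a x * b x) (λ y → a y * b y)) ⟩
      + 2 * (C * C) ∎

  cauchy-schwarz : ∀ {n} (a b : Fin n → ℤ) → sq (∑ (λ x → a x * b x)) ≤ ∑ (sq ∘ a) * ∑ (sq ∘ b)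
  cauchy-schwarz a b = ℤP.0≤i-j⇒j≤i (ℤP.*-cancelˡ-≤-pos 0ℤ _ (+ 2) (begin
    + 2 * 0ℤ                                                  ≡⟨ ℤP.*-zeroʳ (+ 2) ⟩
    0ℤ                                                        ≤⟨ ∑-nonneg (λ x → ∑-nonneg (λ y → sq-nonneg (a x * b y - a y * b x))) ⟩
    ∑ (λ x → ∑ (λ y → sq (a x * b y - a y * b x)))            ≡⟨ lagrange-identity a b ⟩
    + 2 * (∑ (sq ∘ a) * ∑ (sq ∘ b) - sq (∑ (λ x → a x * b x))) ∎))
    where open ℤP.≤-Reasoning

  -- Cauchy–Schwarz over the rows, then expand the square: the diagonal contributes at most m ∑ β²,
  -- the off-diagonal terms at most (∑ ∣β∣)² ≤ n ∑ β².
  module BilinearBound {m n : ℕ} (M : Fin m → Fin n → ℤ)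
    (column-norm : ∀ v → ∑ (λ u → sq (M u v)) ≤ + m)
    (columns-nearly-orthogonal : ∀ v₁ v₂ → v₁ ≢ v₂ → ℤ.∣ ∑ (λ u → M u v₁ * M u v₂) ∣ ℕ.≤ 1) where

    correlation : Fin n → Fin n → ℤ
    correlation v₁ v₂ = ∑ (λ u → M u v₁ * M u v₂)

    ∣_∣ᶻ : ℤ → ℤ
    ∣ i ∣ᶻ = + ℤ.∣ i ∣

    weighted-correlation≤ : ∀ (β : Fin n → ℤ) v₁ v₂ →
      (β v₁ * β v₂) * correlation v₁ v₂ ≤ ∣ β v₁ ∣ᶻ * ∣ β v₂ ∣ᶻ + 𝟙 (v₂ Fin.≟ v₁) * (+ m * (β v₂ * β v₁))
    weighted-correlation≤ β v₁ v₂ with v₂ Fin.≟ v₁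
    ... | yes refl = begin
      (β v₁ * β v₁) * correlation v₁ v₁          ≤⟨ *-monoˡ-≤-0≤ (β v₁ * β v₁) (sq-nonneg (β v₁)) (column-norm v₁) ⟩
      (β v₁ * β v₁) * + m                        ≡⟨ rearrange (β v₁) (+ m) ⟩
      0ℤ + 1ℤ * (+ m * (β v₁ * β v₁))           ≤⟨ ℤP.+-monoˡ-≤ _ (sq-nonneg ∣ β v₁ ∣ᶻ) ⟩
      ∣ β v₁ ∣ᶻ * ∣ β v₁ ∣ᶻ + 1ℤ * (+ m * (β v₁ * β v₁)) ∎
      where
      open ℤP.≤-Reasoning
      rearrange : ∀ b k → (b * b) * k ≡ 0ℤ + 1ℤ * (k * (b * b))
      rearrange = solve-∀
    ... | no v₂≢v₁ = begin
      (β v₁ * β v₂) * correlation v₁ v₂          ≤⟨ i*j≤∣i∣ (β v₁ * β v₂) _ (columns-nearly-orthogonal v₁ v₂ (v₂≢v₁ ∘ sym)) ⟩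
      ∣ β v₁ * β v₂ ∣ᶻ                           ≡⟨ cong +_ (ℤP.abs-* (β v₁) (β v₂)) ⟩
      + (ℤ.∣ β v₁ ∣ ℕ.* ℤ.∣ β v₂ ∣)              ≡⟨ ℤP.pos-* ℤ.∣ β v₁ ∣ ℤ.∣ β v₂ ∣ ⟩
      ∣ β v₁ ∣ᶻ * ∣ β v₂ ∣ᶻ                       ≡⟨ plus-zero (∣ β v₁ ∣ᶻ * ∣ β v₂ ∣ᶻ) (+ m * (β v₂ * β v₁)) ⟩
      ∣ β v₁ ∣ᶻ * ∣ β v₂ ∣ᶻ + 0ℤ * (+ m * (β v₂ * β v₁)) ∎
      where
      open ℤP.≤-Reasoning
      plus-zero : ∀ x y → x ≡ x + 0ℤ * y
      plus-zero = solve-∀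

    ∑∣β∣²≤ : ∀ (β : Fin n → ℤ) → sq (∑ (λ v → ∣ β v ∣ᶻ)) ≤ + n * ∑ (sq ∘ β)
    ∑∣β∣²≤ β = begin
      sq (∑ (λ v → ∣ β v ∣ᶻ))                          ≡⟨ cong sq (∑-cong (λ v → ℤP.*-identityˡ ∣ β v ∣ᶻ)) ⟨
      sq (∑ (λ v → 1ℤ * ∣ β v ∣ᶻ))                     ≤⟨ cauchy-schwarz (λ _ → 1ℤ) (λ v → ∣ β v ∣ᶻ) ⟩
      ∑ (λ _ → 1ℤ * 1ℤ) * ∑ (λ v → sq ∣ β v ∣ᶻ)        ≡⟨ cong₂ _*_ (trans (∑-const 1ℤ) (ℤP.*-identityʳ (+ n))) (∑-cong (λ v → sq-∣∣ (β v))) ⟩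
      + n * ∑ (sq ∘ β)                                 ∎
      where open ℤP.≤-Reasoning

    row : (Fin n → ℤ) → Fin m → ℤ
    row β u = ∑ (λ v → β v * M u v)

    ∑row²≡ : ∀ (β : Fin n → ℤ) → ∑ (λ u → sq (row β u)) ≡ ∑ (λ v₁ → ∑ (λ v₂ → (β v₁ * β v₂) * correlation v₁ v₂))
    ∑row²≡ β = begin
      ∑ (λ u → sq (row β u))
        ≡⟨ ∑-cong (λ u → ∑-product (λ v₁ → β v₁ * M u v₁) (λ v₂ → β v₂ * M u v₂)) ⟨
      ∑ (λ u → ∑ (λ v₁ → ∑ (λ v₂ → (β v₁ * M u v₁) * (β v₂ * M u v₂))))
        ≡⟨ ∑-comm _ ⟩
      ∑ (λ v₁ → ∑ (λ u → ∑ (λ v₂ → (β v₁ * M u v₁) * (β v₂ * M u v₂))))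
        ≡⟨ ∑-cong (λ v₁ → ∑-comm _) ⟩
      ∑ (λ v₁ → ∑ (λ v₂ → ∑ (λ u → (β v₁ * M u v₁) * (β v₂ * M u v₂))))
        ≡⟨ ∑-cong (λ v₁ → ∑-cong (λ v₂ → trans (∑-cong (λ u → regroup (β v₁) (β v₂) (M u v₁) (M u v₂))) (∑-*ˡ (β v₁ * β v₂) (λ u → M u v₁ * M u v₂)))) ⟩
      ∑ (λ v₁ → ∑ (λ v₂ → (β v₁ * β v₂) * correlation v₁ v₂))
        ∎
      where
      open ≡-Reasoning
      regroup : ∀ a b c d → (a * c) * (b * d) ≡ (a * b) * (c * d)
      regroup = solve-∀

    ∑row²≤ : ∀ (β : Fin n → ℤ) → ∑ (λ u → sq (row β u)) ≤ (+ m + + n) * ∑ (sq ∘ β)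
    ∑row²≤ β = begin
      ∑ (λ u → sq (row β u))                                          ≡⟨ ∑row²≡ β ⟩
      ∑ (λ v₁ → ∑ (λ v₂ → (β v₁ * β v₂) * correlation v₁ v₂))         ≤⟨ ∑-mono (λ v₁ → ∑-mono (weighted-correlation≤ β v₁)) ⟩
      ∑ (λ v₁ → ∑ (λ v₂ → ∣ β v₁ ∣ᶻ * ∣ β v₂ ∣ᶻ + 𝟙 (v₂ Fin.≟ v₁) * (+ m * (β v₂ * β v₁))))
        ≡⟨ trans (∑-cong (λ v₁ → ∑-+ _ _)) (∑-+ _ _) ⟩
      ∑ (λ v₁ → ∑ (λ v₂ → ∣ β v₁ ∣ᶻ * ∣ β v₂ ∣ᶻ)) + ∑ (λ v₁ → ∑ (λ v₂ → 𝟙 (v₂ Fin.≟ v₁) * (+ m * (β v₂ * β v₁))))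
        ≡⟨ cong₂ _+_ (∑-product (λ v → ∣ β v ∣ᶻ) (λ v → ∣ β v ∣ᶻ)) (trans (∑-cong (λ v₁ → ∑-δ v₁ _)) (∑-*ˡ (+ m) (sq ∘ β))) ⟩
      sq (∑ (λ v → ∣ β v ∣ᶻ)) + + m * ∑ (sq ∘ β)                      ≤⟨ ℤP.+-monoˡ-≤ _ (∑∣β∣²≤ β) ⟩
      + n * ∑ (sq ∘ β) + + m * ∑ (sq ∘ β)                             ≡⟨ collect (+ n) (+ m) (∑ (sq ∘ β)) ⟩
      (+ m + + n) * ∑ (sq ∘ β)                                        ∎
      where
      open ℤP.≤-Reasoning
      collect : ∀ a b s → a * s + b * s ≡ (b + a) * s
      collect = solve-∀

    bilinear-bound : ∀ (α : Fin m → ℤ) (β : Fin n → ℤ) →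
      sq (∑ (λ u → ∑ (λ v → (α u * β v) * M u v))) ≤ ∑ (sq ∘ α) * ((+ m + + n) * ∑ (sq ∘ β))
    bilinear-bound α β = begin
      sq (∑ (λ u → ∑ (λ v → (α u * β v) * M u v)))     ≡⟨ cong sq (∑-cong (λ u → trans (∑-cong (λ v → ℤP.*-assoc (α u) (β v) (M u v))) (∑-*ˡ (α u) _))) ⟩
      sq (∑ (λ u → α u * row β u))                      ≤⟨ cauchy-schwarz α (row β) ⟩
      ∑ (sq ∘ α) * ∑ (λ u → sq (row β u))               ≤⟨ *-monoˡ-≤-0≤ (∑ (sq ∘ α)) (∑-nonneg (sq-nonneg ∘ α)) (∑row²≤ β) ⟩
      ∑ (sq ∘ α) * ((+ m + + n) * ∑ (sq ∘ β))           ∎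
      where open ℤP.≤-Reasoning

module Counting where

  open import Data.Nat using (zero; suc)
  open import Data.Fin using (Fin; zero; suc)
  open import Data.Fin.Subset using (Subset; ∣_∣; inside; outside)
  open import Data.Fin.Subset.Properties using (_∈?_)
  open import Data.Integer as ℤ using (ℤ; +_; 0ℤ; 1ℤ)
  import Data.Integer.Properties as ℤP
  open import Data.List as List using (List; []; _∷_; _++_; filter; length; tabulate; cartesianProduct; allFin)
  open import Data.Vec using ([]; _∷_)
  open import Data.Product using (_×_; _,_)
  open import Relation.Binary.PropositionalEquality
  open import Relation.Nullary using (Dec; yes; no)
  open import Relation.Nullary.Decidable using (_×-dec_; map′)
  open import Function using (_∘_)
  open IntegerSums

  listSum : ∀ {A : Set} → (A → ℤ) → List A → ℤ
  listSum φ = List.foldr (λ x s → φ x ℤ.+ s) 0ℤ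

  length-filter : ∀ {A : Set} {P : A → Set} (P? : ∀ x → Dec (P x)) xs → + length (filter P? xs) ≡ listSum (𝟙 ∘ P?) xs
  length-filter P? []       = refl
  length-filter P? (x ∷ xs) with P? x
  ... | yes _ = trans (ℤP.pos-+ 1 (length (filter P? xs))) (cong (ℤ._+_ 1ℤ) (length-filter P? xs))
  ... | no _  = trans (length-filter P? xs) (sym (ℤP.+-identityˡ _))

  listSum-++ : ∀ {A : Set} (φ : A → ℤ) xs ys → listSum φ (xs ++ ys) ≡ listSum φ xs ℤ.+ listSum φ ys
  listSum-++ φ []       ys = sym (ℤP.+-identityˡ _)
  listSum-++ φ (x ∷ xs) ys = trans (cong (ℤ._+_ (φ x)) (listSum-++ φ xs ys)) (sym (ℤP.+-assoc (φ x) _ _))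

  listSum-map : ∀ {A B : Set} (φ : B → ℤ) (f : A → B) xs → listSum φ (List.map f xs) ≡ listSum (φ ∘ f) xs
  listSum-map φ f []       = refl
  listSum-map φ f (x ∷ xs) = cong (ℤ._+_ (φ (f x))) (listSum-map φ f xs)

  listSum-tabulate : ∀ {A : Set} {n} (φ : A → ℤ) (f : Fin n → A) → listSum φ (tabulate f) ≡ ∑ (φ ∘ f)
  listSum-tabulate {n = zero}  φ f = sym (∑-zero (φ ∘ f))
  listSum-tabulate {n = suc n} φ f = trans (cong (ℤ._+_ (φ (f zero))) (listSum-tabulate φ (f ∘ suc))) (sym (∑-suc (φ ∘ f)))

  listSum-cartesianProduct : ∀ {A B : Set} (φ : A × B → ℤ) xs ys →
    listSum φ (cartesianProduct xs ys) ≡ listSum (λ x → listSum (λ y → φ (x , y)) ys) xs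
  listSum-cartesianProduct φ []       ys = refl
  listSum-cartesianProduct φ (x ∷ xs) ys = trans (listSum-++ φ (List.map (x ,_) ys) (cartesianProduct xs ys))
    (cong₂ ℤ._+_ (listSum-map φ (x ,_) ys) (listSum-cartesianProduct φ xs ys))

  #pairs : ∀ {m n} {P : Fin m × Fin n → Set} (P? : ∀ p → Dec (P p)) →
    + length (filter P? (cartesianProduct (allFin m) (allFin n))) ≡ ∑ (λ i → ∑ (λ j → 𝟙 (P? (i , j))))
  #pairs {m} {n} P? = begin
    + length (filter P? (cartesianProduct (allFin m) (allFin n)))
      ≡⟨ length-filter P? (cartesianProduct (allFin m) (allFin n)) ⟩
    listSum (𝟙 ∘ P?) (cartesianProduct (allFin m) (allFin n))
      ≡⟨ listSum-cartesianProduct (𝟙 ∘ P?) (allFin m) (allFin n) ⟩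
    listSum (λ i → listSum (λ j → 𝟙 (P? (i , j))) (allFin n)) (allFin m)
      ≡⟨ listSum-tabulate _ (λ i → i) ⟩
    ∑ (λ i → listSum (λ j → 𝟙 (P? (i , j))) (allFin n))
      ≡⟨ ∑-cong (λ i → listSum-tabulate _ (λ j → j)) ⟩
    ∑ (λ i → ∑ (λ j → 𝟙 (P? (i , j))))
      ∎
    where open ≡-Reasoning

  𝟙-×-dec : ∀ {a b} {P : Set a} {Q : Set b} (p? : Dec P) (q? : Dec Q) → 𝟙 (p? ×-dec q?) ≡ 𝟙 p? ℤ.* 𝟙 q?
  𝟙-×-dec (yes _) (yes _) = refl
  𝟙-×-dec (yes _) (no _)  = refl
  𝟙-×-dec (no _)  (yes _) = refl
  𝟙-×-dec (no _)  (no _)  = refl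

  𝟙-map′ : ∀ {a b} {P : Set a} {Q : Set b} {f : P → Q} {g : Q → P} (p? : Dec P) → 𝟙 (map′ f g p?) ≡ 𝟙 p?
  𝟙-map′ (yes _) = refl
  𝟙-map′ (no _)  = refl

  ∣S∣≡∑𝟙∈ : ∀ {n} (S : Subset n) → + ∣ S ∣ ≡ ∑ (λ x → 𝟙 (x ∈? S))
  ∣S∣≡∑𝟙∈ []            = sym (∑-zero _)
  ∣S∣≡∑𝟙∈ (inside ∷ S)  = begin
    + suc ∣ S ∣                              ≡⟨ ℤP.pos-+ 1 ∣ S ∣ ⟩
    1ℤ ℤ.+ + ∣ S ∣                           ≡⟨ cong (ℤ._+_ 1ℤ) (∣S∣≡∑𝟙∈ S) ⟩
    1ℤ ℤ.+ ∑ (λ x → 𝟙 (x ∈? S))              ≡⟨ cong (ℤ._+_ 1ℤ) (∑-cong (λ x → 𝟙-map′ (x ∈? S))) ⟨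
    1ℤ ℤ.+ ∑ (λ x → 𝟙 (suc x ∈? inside ∷ S)) ≡⟨ ∑-suc _ ⟨
    ∑ (λ x → 𝟙 (x ∈? inside ∷ S))            ∎
    where open ≡-Reasoning
  ∣S∣≡∑𝟙∈ (outside ∷ S) = begin
    + ∣ S ∣                                   ≡⟨ ∣S∣≡∑𝟙∈ S ⟩
    ∑ (λ x → 𝟙 (x ∈? S))                      ≡⟨ ∑-cong (λ x → 𝟙-map′ (x ∈? S)) ⟨
    ∑ (λ x → 𝟙 (suc x ∈? outside ∷ S))        ≡⟨ ℤP.+-identityˡ _ ⟨
    0ℤ ℤ.+ ∑ (λ x → 𝟙 (suc x ∈? outside ∷ S)) ≡⟨ ∑-suc _ ⟨
    ∑ (λ x → 𝟙 (x ∈? outside ∷ S))            ∎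
    where open ≡-Reasoning

module IntegerCoefficientSolver
  {A : Set} {add mul : A → A → A} {neg : A → A} {0ᴬ 1ᴬ : A}
  (isCommutativeRing : IsCommutativeRing _≡_ add mul neg 0ᴬ 1ᴬ) where

  open import Relation.Binary.PropositionalEquality
  open import Data.Nat as ℕ using (ℕ; suc)
  import Data.Nat.Properties as ℕP
  open import Data.Integer as ℤ using (ℤ; +_; -[1+_]; _⊖_; _◃_; sign; ∣_∣)
  import Data.Integer.Properties as ℤP
  open import Data.Sign as Sign using (Sign)
  open import Data.Maybe as Maybe using ()
  open import Algebra.Bundles using (CommutativeRing)
  open import Algebra.Solver.Ring.AlmostCommutativeRing using (_-Raw-AlmostCommutative⟶_; fromCommutativeRing)
  open import Relation.Binary.Consequences using (dec⇒weaklyDec)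

  commutativeRing : CommutativeRing _ _
  commutativeRing = record { isCommutativeRing = isCommutativeRing }

  open CommutativeRing commutativeRing
    using (_+_; _*_; -_; 0#; 1#; +-comm; +-identityˡ; +-identityʳ; -‿inverseʳ; ring; semiring; +-commutativeSemigroup)
  open import Algebra.Properties.Ring ring using (-‿involutive; -0#≈0#; -‿distribˡ-*; -‿distribʳ-*; -‿+-comm)
  open import Algebra.Properties.Semiring.Mult.TCOptimised semiring using (_×_; 1+×; ×-homo-+; ×1-homo-*)
  open import Algebra.Properties.CommutativeSemigroup +-commutativeSemigroup using (interchange)
  open ≡-Reasoning

  -- Normal forms must compute, so constants are integers mapped into the ring rather than ring elements.
  fromℤ : ℤ → A
  fromℤ (+ n)    = n × 1#
  fromℤ -[1+ n ] = - (suc n × 1#)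

  private
    signed : Sign → A → A
    signed Sign.+ x = x
    signed Sign.- x = - x

    signed-* : ∀ s t x y → signed (s Sign.* t) (x * y) ≡ signed s x * signed t y
    signed-* Sign.+ Sign.+ x y = refl
    signed-* Sign.+ Sign.- x y = -‿distribʳ-* x y
    signed-* Sign.- Sign.+ x y = -‿distribˡ-* x y
    signed-* Sign.- Sign.- x y = begin
      x * y          ≡⟨ -‿involutive (x * y) ⟨
      - - (x * y)    ≡⟨ cong -_ (-‿distribʳ-* x y) ⟩
      - (x * - y)    ≡⟨ -‿distribˡ-* x (- y) ⟩
      - x * - y      ∎

    fromℤ-signed : ∀ i → fromℤ i ≡ signed (sign i) (∣ i ∣ × 1#)
    fromℤ-signed (+ n)    = refl
    fromℤ-signed -[1+ n ] = refl

    fromℤ-◃ : ∀ s n → fromℤ (s ◃ n) ≡ signed s (n × 1#)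
    fromℤ-◃ Sign.+ ℕ.zero  = refl
    fromℤ-◃ Sign.- ℕ.zero  = sym -0#≈0#
    fromℤ-◃ Sign.+ (suc n) = refl
    fromℤ-◃ Sign.- (suc n) = refl

    fromℤ-⊖ : ∀ m n → fromℤ (m ⊖ n) ≡ m × 1# + - (n × 1#)
    fromℤ-⊖ ℕ.zero  ℕ.zero  = sym (trans (+-identityˡ (- 0#)) -0#≈0#)
    fromℤ-⊖ ℕ.zero  (suc n) = sym (+-identityˡ _)
    fromℤ-⊖ (suc m) ℕ.zero  = sym (trans (cong (_+_ (suc m × 1#)) -0#≈0#) (+-identityʳ _))
    fromℤ-⊖ (suc m) (suc n) = begin
      fromℤ (suc m ⊖ suc n)                   ≡⟨ cong fromℤ (ℤP.[1+m]⊖[1+n]≡m⊖n m n) ⟩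
      fromℤ (m ⊖ n)                           ≡⟨ fromℤ-⊖ m n ⟩
      m × 1# + - (n × 1#)                     ≡⟨ +-identityˡ _ ⟨
      0# + (m × 1# + - (n × 1#))              ≡⟨ cong (_+ (m × 1# + - (n × 1#))) (-‿inverseʳ 1#) ⟨
      (1# + - 1#) + (m × 1# + - (n × 1#))     ≡⟨ interchange 1# (- 1#) (m × 1#) (- (n × 1#)) ⟩
      (1# + m × 1#) + (- 1# + - (n × 1#))     ≡⟨ cong (_+_ (1# + m × 1#)) (-‿+-comm 1# (n × 1#)) ⟩
      (1# + m × 1#) + - (1# + n × 1#)         ≡⟨ cong₂ (λ x y → x + - y) (1+× m 1#) (1+× n 1#) ⟨
      suc m × 1# + - (suc n × 1#)             ∎

  fromℤ-+ : ∀ i j → fromℤ (i ℤ.+ j) ≡ fromℤ i + fromℤ j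
  fromℤ-+ (+ m)    (+ n)    = ×-homo-+ 1# m n
  fromℤ-+ (+ m)    -[1+ n ] = fromℤ-⊖ m (suc n)
  fromℤ-+ -[1+ m ] (+ n)    = trans (fromℤ-⊖ n (suc m)) (+-comm _ _)
  fromℤ-+ -[1+ m ] -[1+ n ] = begin
    - (suc (suc (m ℕ.+ n)) × 1#)           ≡⟨ cong (λ k → - (suc k × 1#)) (ℕP.+-suc m n) ⟨
    - ((suc m ℕ.+ suc n) × 1#)             ≡⟨ cong -_ (×-homo-+ 1# (suc m) (suc n)) ⟩
    - (suc m × 1# + suc n × 1#)            ≡⟨ -‿+-comm _ _ ⟨
    - (suc m × 1#) + - (suc n × 1#)        ∎

  fromℤ-* : ∀ i j → fromℤ (i ℤ.* j) ≡ fromℤ i * fromℤ j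
  fromℤ-* i j = begin
    fromℤ (i ℤ.* j)                                             ≡⟨ fromℤ-◃ (sign i Sign.* sign j) (∣ i ∣ ℕ.* ∣ j ∣) ⟩
    signed (sign i Sign.* sign j) ((∣ i ∣ ℕ.* ∣ j ∣) × 1#)      ≡⟨ cong (signed (sign i Sign.* sign j)) (×1-homo-* ∣ i ∣ ∣ j ∣) ⟩
    signed (sign i Sign.* sign j) ((∣ i ∣ × 1#) * (∣ j ∣ × 1#)) ≡⟨ signed-* (sign i) (sign j) _ _ ⟩
    signed (sign i) (∣ i ∣ × 1#) * signed (sign j) (∣ j ∣ × 1#) ≡⟨ cong₂ _*_ (fromℤ-signed i) (fromℤ-signed j) ⟨
    fromℤ i * fromℤ j                                           ∎

  fromℤ-neg : ∀ i → fromℤ (ℤ.- i) ≡ - fromℤ i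
  fromℤ-neg (+ ℕ.zero) = sym -0#≈0#
  fromℤ-neg (+ suc n)  = refl
  fromℤ-neg -[1+ n ]   = sym (-‿involutive _)

  fromℤ-morphism : ℤ.+-*-rawRing -Raw-AlmostCommutative⟶ fromCommutativeRing commutativeRing
  fromℤ-morphism = record
    { ⟦_⟧    = fromℤ
    ; +-homo = fromℤ-+
    ; *-homo = fromℤ-*
    ; -‿homo = fromℤ-neg
    ; 0-homo = refl
    ; 1-homo = refl
    }

  open import Algebra.Solver.Ring ℤ.+-*-rawRing (fromCommutativeRing commutativeRing) fromℤ-morphism
    (λ i j → Maybe.map (cong fromℤ) (dec⇒weaklyDec ℤ._≟_ i j)) public
    using (solve; _:=_; con; _:+_; _:*_; _:-_; :-_)

module FieldFacts {q : ℕ} (𝔽 : FiniteField q) where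

  open import Data.Fin as Fin using (Fin)
  open import Data.Nat.DivMod using (_%_)
  open import Data.Product using (∃; _×_; _,_; proj₁; proj₂)
  import Data.Integer as ℤ
  open import Data.Sum using (_⊎_; inj₁; inj₂)
  open import Data.Empty using (⊥-elim)
  open import Relation.Binary.PropositionalEquality
  open import Relation.Nullary using (¬_; Dec; yes; no)
  open import Algebra.Bundles using (CommutativeRing)
  open IntegerSums using (fixedPointFree-involution⇒even)

  open IntegerCoefficientSolver (FiniteField.isCommutativeRing 𝔽) public
  open CommutativeRing commutativeRing public
    using (_+_; _*_; -_; 0#; 1#; +-identityˡ; +-identityʳ; -‿inverseʳ; *-assoc; *-comm; *-identityˡ; *-identityʳ; zeroˡ; zeroʳ)
  open CommutativeRing commutativeRing using (+-assoc; +-group; ring)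
  open import Algebra.Properties.Group +-group public using (x∙y⁻¹≈ε⇒x≈y; x≈y⇒x∙y⁻¹≈ε)
  open import Algebra.Properties.Ring ring public using (-0#≈0#; -‿involutive)
  open FiniteField 𝔽 using (0≢1; inverse)
  open ≡-Reasoning

  F : Set
  F = Fin q

  infix 4 _≟_
  _≟_ : (x y : F) → Dec (x ≡ y)
  _≟_ = Fin._≟_

  -- Division by zero is given the junk value 0⁻¹ = 0.
  _⁻¹ : F → F
  x ⁻¹ with x ≟ 0#
  ... | yes _   = 0#
  ... | no x≢0 = proj₁ (inverse x x≢0)

  x*x⁻¹≡1 : ∀ {x} → x ≢ 0# → x * x ⁻¹ ≡ 1#
  x*x⁻¹≡1 {x} x≢0 with x ≟ 0#
  ... | yes x≡0  = ⊥-elim (x≢0 x≡0)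
  ... | no x≢0′  = proj₂ (inverse x x≢0′)

  x⁻¹*x≡1 : ∀ {x} → x ≢ 0# → x ⁻¹ * x ≡ 1#
  x⁻¹*x≡1 {x} x≢0 = trans (*-comm (x ⁻¹) x) (x*x⁻¹≡1 x≢0)

  0⁻¹≡0 : 0# ⁻¹ ≡ 0#
  0⁻¹≡0 with 0# ≟ 0#
  ... | yes _   = refl
  ... | no 0≢0 = ⊥-elim (0≢0 refl)

  x⁻¹*[x*y]≡y : ∀ {x} y → x ≢ 0# → x ⁻¹ * (x * y) ≡ y
  x⁻¹*[x*y]≡y {x} y x≢0 = begin
    x ⁻¹ * (x * y)  ≡⟨ *-assoc (x ⁻¹) x y ⟨
    (x ⁻¹ * x) * y  ≡⟨ cong (_* y) (x⁻¹*x≡1 x≢0) ⟩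
    1# * y          ≡⟨ *-identityˡ y ⟩
    y               ∎

  x*[x⁻¹*y]≡y : ∀ {x} y → x ≢ 0# → x * (x ⁻¹ * y) ≡ y
  x*[x⁻¹*y]≡y {x} y x≢0 = begin
    x * (x ⁻¹ * y)  ≡⟨ *-assoc x (x ⁻¹) y ⟨
    (x * x ⁻¹) * y  ≡⟨ cong (_* y) (x*x⁻¹≡1 x≢0) ⟩
    1# * y          ≡⟨ *-identityˡ y ⟩
    y               ∎

  *-cancelˡ : ∀ {a} x y → a ≢ 0# → a * x ≡ a * y → x ≡ y
  *-cancelˡ {a} x y a≢0 ax≡ay = begin
    x               ≡⟨ x⁻¹*[x*y]≡y x a≢0 ⟨
    a ⁻¹ * (a * x)  ≡⟨ cong (a ⁻¹ *_) ax≡ay ⟩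
    a ⁻¹ * (a * y)  ≡⟨ x⁻¹*[x*y]≡y y a≢0 ⟩
    y               ∎

  x*y≡0⇒x≡0∨y≡0 : ∀ x y → x * y ≡ 0# → x ≡ 0# ⊎ y ≡ 0#
  x*y≡0⇒x≡0∨y≡0 x y xy≡0 with x ≟ 0#
  ... | yes x≡0 = inj₁ x≡0
  ... | no x≢0  = inj₂ (*-cancelˡ y 0# x≢0 (trans xy≡0 (sym (zeroʳ x))))

  *-≢0 : ∀ {x y} → x ≢ 0# → y ≢ 0# → x * y ≢ 0#
  *-≢0 {x} {y} x≢0 y≢0 xy≡0 with x*y≡0⇒x≡0∨y≡0 x y xy≡0
  ... | inj₁ x≡0 = x≢0 x≡0
  ... | inj₂ y≡0 = y≢0 y≡0

  ⁻¹-≢0 : ∀ {x} → x ≢ 0# → x ⁻¹ ≢ 0#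
  ⁻¹-≢0 {x} x≢0 x⁻¹≡0 = 0≢1 (begin
    0#          ≡⟨ zeroʳ x ⟨
    x * 0#      ≡⟨ cong (x *_) x⁻¹≡0 ⟨
    x * x ⁻¹    ≡⟨ x*x⁻¹≡1 x≢0 ⟩
    1#          ∎)

  ⁻¹-involutive : ∀ x → x ⁻¹ ⁻¹ ≡ x
  ⁻¹-involutive x = by-cases (x ≟ 0#)
    where
    by-cases : Dec (x ≡ 0#) → x ⁻¹ ⁻¹ ≡ x
    by-cases (yes refl) = trans (cong _⁻¹ 0⁻¹≡0) 0⁻¹≡0
    by-cases (no x≢0)   = *-cancelˡ (x ⁻¹ ⁻¹) x (⁻¹-≢0 x≢0) (trans (x*x⁻¹≡1 (⁻¹-≢0 x≢0)) (sym (x⁻¹*x≡1 x≢0)))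

  linear-root-unique : ∀ {A B} → ¬ (A ≡ 0# × B ≡ 0#) → ∃ λ r → ∀ x → A * x + B ≡ 0# → x ≡ r
  linear-root-unique {A} {B} not-both-0 with A ≟ 0#
  ... | yes A≡0 = 0# , λ x Ax+B≡0 → ⊥-elim (not-both-0 (A≡0 , (begin
    B             ≡⟨ solve 2 (λ x B → B := con (ℤ.+ 0) :* x :+ B) refl x B ⟩
    0# * x + B    ≡⟨ cong (λ t → t * x + B) A≡0 ⟨
    A * x + B     ≡⟨ Ax+B≡0 ⟩
    0#            ∎)))
  ... | no A≢0 = A ⁻¹ * - B , λ x Ax+B≡0 → *-cancelˡ x (A ⁻¹ * - B) A≢0 (begin
    A * x                 ≡⟨ solve 2 (λ y B → y := (y :+ B) :- B) refl (A * x) B ⟩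
    (A * x + B) + - B     ≡⟨ cong (_+ - B) Ax+B≡0 ⟩
    0# + - B              ≡⟨ +-identityˡ (- B) ⟩
    - B                   ≡⟨ x*[x⁻¹*y]≡y (- B) A≢0 ⟨
    A * (A ⁻¹ * - B)      ∎)

  1+1≢0 : q % 2 ≡ 1 → 1# + 1# ≢ 0#
  1+1≢0 q-odd 1+1≡0 = 1≢0 (trans (sym q-odd) (fixedPointFree-involution⇒even (_+ 1#) shift-twice shift-moves))
    where
    1≢0 : 1 ≢ 0
    1≢0 ()
    shift-twice : ∀ x → (x + 1#) + 1# ≡ x
    shift-twice x = trans (+-assoc x 1# 1#) (trans (cong (x +_) 1+1≡0) (+-identityʳ x))
    shift-moves : ∀ x → x + 1# ≢ x
    shift-moves x x+1≡x = 0≢1 (sym (begin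
      1#                  ≡⟨ solve 2 (λ x o → o := (x :+ o) :- x) refl x 1# ⟩
      (x + 1#) + - x      ≡⟨ cong (_+ - x) x+1≡x ⟩
      x + - x             ≡⟨ -‿inverseʳ x ⟩
      0#                  ∎))

module QuadraticCharacter {q : ℕ} (𝔽 : FiniteField q) (q-odd : q ℕ.% 2 ≡ 1) where

  open import Data.Integer as ℤ using (ℤ; 0ℤ; 1ℤ; -1ℤ)
  import Data.Integer.Properties as ℤP
  open import Data.Integer.Tactic.RingSolver using (solve-∀)
  open import Data.Product using (_,_)
  open import Data.Sum using (_⊎_; inj₁; inj₂)
  open import Data.Empty using (⊥-elim)
  open import Relation.Binary.PropositionalEquality
  open import Relation.Nullary using (¬_; yes; no)
  open IntegerSums
  open FieldFacts 𝔽 public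
  open FF 𝔽 public using (IsSquare; isSquare?)
  open ≡-Reasoning

  χ : F → ℤ
  χ x with x ≟ 0# | isSquare? x
  ... | yes _ | _     = 0ℤ
  ... | no _  | yes _ = 1ℤ
  ... | no _  | no _  = -1ℤ

  χ-zero : ∀ {x} → x ≡ 0# → χ x ≡ 0ℤ
  χ-zero {x} x≡0 with x ≟ 0#
  ... | yes _  = refl
  ... | no x≢0 = ⊥-elim (x≢0 x≡0)

  χ-square : ∀ {x} → x ≢ 0# → IsSquare x → χ x ≡ 1ℤ
  χ-square {x} x≢0 □x with x ≟ 0# | isSquare? x
  ... | yes x≡0 | _      = ⊥-elim (x≢0 x≡0)
  ... | no _    | yes _  = refl
  ... | no _    | no ¬□x = ⊥-elim (¬□x □x)

  nonsquare-≢0 : ∀ {x} → ¬ IsSquare x → x ≢ 0#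
  nonsquare-≢0 ¬□x refl = ¬□x (0# , zeroˡ 0#)

  χ-nonsquare : ∀ {x} → ¬ IsSquare x → χ x ≡ -1ℤ
  χ-nonsquare {x} ¬□x with x ≟ 0# | isSquare? x
  ... | yes x≡0 | _      = ⊥-elim (nonsquare-≢0 ¬□x x≡0)
  ... | no _    | yes □x = ⊥-elim (¬□x □x)
  ... | no _    | no _   = refl

  data Residue (x : F) : Set where
    zero      : x ≡ 0# → Residue x
    square    : x ≢ 0# → IsSquare x → Residue x
    nonsquare : ¬ IsSquare x → Residue x

  residue : ∀ x → Residue x
  residue x with x ≟ 0# | isSquare? x
  ... | yes x≡0 | _      = zero x≡0
  ... | no x≢0  | yes □x = square x≢0 □x
  ... | no _    | no ¬□x = nonsquare ¬□x

  ∣χ∣≤1 : ∀ x → ℤ.∣ χ x ∣ ℕ.≤ 1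
  ∣χ∣≤1 x with residue x
  ... | zero x≡0       = subst (λ v → ℤ.∣ v ∣ ℕ.≤ 1) (sym (χ-zero x≡0)) ℕ.z≤n
  ... | square x≢0 □x  = subst (λ v → ℤ.∣ v ∣ ℕ.≤ 1) (sym (χ-square x≢0 □x)) (ℕ.s≤s ℕ.z≤n)
  ... | nonsquare ¬□x  = subst (λ v → ℤ.∣ v ∣ ℕ.≤ 1) (sym (χ-nonsquare ¬□x)) (ℕ.s≤s ℕ.z≤n)

  x²≡z²⇒x≡±z : ∀ x z → x * x ≡ z * z → x ≡ z ⊎ x ≡ - z
  x²≡z²⇒x≡±z x z x²≡z² with x*y≡0⇒x≡0∨y≡0 (x + - z) (x + z) (begin
      (x + - z) * (x + z)  ≡⟨ solve 2 (λ x z → (x :- z) :* (x :+ z) := x :* x :- z :* z) refl x z ⟩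
      x * x + - (z * z)    ≡⟨ x≈y⇒x∙y⁻¹≈ε x²≡z² ⟩
      0#                   ∎)
  ... | inj₁ x-z≡0 = inj₁ (x∙y⁻¹≈ε⇒x≈y x z x-z≡0)
  ... | inj₂ x+z≡0 = inj₂ (x∙y⁻¹≈ε⇒x≈y x (- z) (trans (cong (x +_) (-‿involutive z)) x+z≡0))

  z≢-z : ∀ {z} → z ≢ 0# → z ≢ - z
  z≢-z {z} z≢0 z≡-z with x*y≡0⇒x≡0∨y≡0 (1# + 1#) z (begin
      (1# + 1#) * z  ≡⟨ solve 1 (λ z → (con (ℤ.+ 1) :+ con (ℤ.+ 1)) :* z := z :+ z) refl z ⟩
      z + z          ≡⟨ cong (z +_) z≡-z ⟩
      z + - z        ≡⟨ -‿inverseʳ z ⟩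
      0#             ∎)
  ... | inj₁ 2≡0 = 1+1≢0 q-odd 2≡0
  ... | inj₂ z≡0 = z≢0 z≡0

  ∑-square-roots : ∀ y → ∑ (λ x → 𝟙 (x * x ≟ y)) ≡ 1ℤ ℤ.+ χ y
  ∑-square-roots y with residue y
  ... | zero y≡0 = begin
    ∑ (λ x → 𝟙 (x * x ≟ y))  ≡⟨ ∑-cong (λ x → 𝟙-cong (x * x ≟ y) (x ≟ 0#) (root-is-0 x) (0-is-root x)) ⟩
    ∑ (λ x → 𝟙 (x ≟ 0#))     ≡⟨ ∑-𝟙≡ 0# ⟩
    1ℤ                        ≡⟨ cong (ℤ._+_ 1ℤ) (χ-zero y≡0) ⟨
    1ℤ ℤ.+ χ y                ∎
    where
    root-is-0 : ∀ x → x * x ≡ y → x ≡ 0#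
    root-is-0 x x²≡y with x*y≡0⇒x≡0∨y≡0 x x (trans x²≡y y≡0)
    ... | inj₁ x≡0 = x≡0
    ... | inj₂ x≡0 = x≡0
    0-is-root : ∀ x → x ≡ 0# → x * x ≡ y
    0-is-root x refl = trans (zeroˡ 0#) (sym y≡0)
  ... | square y≢0 (z , z²≡y) = begin
    ∑ (λ x → 𝟙 (x * x ≟ y))                         ≡⟨ ∑-cong two-roots ⟩
    ∑ (λ x → 𝟙 (x ≟ z) ℤ.+ 𝟙 (x ≟ - z))             ≡⟨ ∑-+ _ _ ⟩
    ∑ (λ x → 𝟙 (x ≟ z)) ℤ.+ ∑ (λ x → 𝟙 (x ≟ - z))   ≡⟨ cong₂ ℤ._+_ (∑-𝟙≡ z) (∑-𝟙≡ (- z)) ⟩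
    1ℤ ℤ.+ 1ℤ                                        ≡⟨ cong (ℤ._+_ 1ℤ) (χ-square y≢0 (z , z²≡y)) ⟨
    1ℤ ℤ.+ χ y                                       ∎
    where
    z≢0 : z ≢ 0#
    z≢0 refl = y≢0 (trans (sym z²≡y) (zeroˡ 0#))
    [-z]²≡y : - z * - z ≡ y
    [-z]²≡y = trans (solve 1 (λ z → (:- z) :* (:- z) := z :* z) refl z) z²≡y
    two-roots : ∀ x → 𝟙 (x * x ≟ y) ≡ 𝟙 (x ≟ z) ℤ.+ 𝟙 (x ≟ - z)
    two-roots x with x ≟ z | x ≟ - z | x * x ≟ y
    ... | yes refl | yes x≡-x | _         = ⊥-elim (z≢-z z≢0 x≡-x)
    ... | yes refl | no _     | yes _     = refl
    ... | yes refl | no _     | no x²≢y   = ⊥-elim (x²≢y z²≡y)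
    ... | no _     | yes refl | yes _     = refl
    ... | no _     | yes refl | no x²≢y   = ⊥-elim (x²≢y [-z]²≡y)
    ... | no x≢z   | no x≢-z  | yes x²≡y with x²≡z²⇒x≡±z x z (trans x²≡y (sym z²≡y))
    ...   | inj₁ x≡z  = ⊥-elim (x≢z x≡z)
    ...   | inj₂ x≡-z = ⊥-elim (x≢-z x≡-z)
    two-roots x | no _ | no _ | no _ = refl
  ... | nonsquare ¬□y = begin
    ∑ (λ x → 𝟙 (x * x ≟ y))  ≡⟨ ∑-cong (λ x → 𝟙-no (x * x ≟ y) (λ x²≡y → ¬□y (x , x²≡y))) ⟩
    ∑ (λ x → 0ℤ)             ≡⟨ ∑-const 0ℤ ⟩
    ℤ.+ q ℤ.* 0ℤ             ≡⟨ ℤP.*-zeroʳ (ℤ.+ q) ⟩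
    0ℤ                        ≡⟨ cong (ℤ._+_ 1ℤ) (χ-nonsquare ¬□y) ⟨
    1ℤ ℤ.+ χ y                ∎

  -- Every x is the square root of exactly one y, so ∑ (1 + χ) = q.
  ∑χ≡0 : ∑ χ ≡ 0ℤ
  ∑χ≡0 = begin
    ∑ χ                                                 ≡⟨ ∑-cong (λ y → trans (plus-minus (χ y)) (cong (ℤ._- 1ℤ) (sym (∑-square-roots y)))) ⟩
    ∑ (λ y → ∑ (λ x → 𝟙 (x * x ≟ y)) ℤ.- 1ℤ)            ≡⟨ ∑-sub _ _ ⟩
    ∑ (λ y → ∑ (λ x → 𝟙 (x * x ≟ y))) ℤ.- ∑ (λ _ → 1ℤ)  ≡⟨ cong (ℤ._- ∑ (λ _ → 1ℤ)) (∑-comm _) ⟩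
    ∑ (λ x → ∑ (λ y → 𝟙 (x * x ≟ y))) ℤ.- ∑ (λ _ → 1ℤ)  ≡⟨ cong (ℤ._- ∑ (λ _ → 1ℤ)) (∑-cong (λ x → one-square x)) ⟩
    ∑ (λ _ → 1ℤ) ℤ.- ∑ (λ _ → 1ℤ)                       ≡⟨ ℤP.+-inverseʳ (∑ (λ _ → 1ℤ)) ⟩
    0ℤ                                                  ∎
    where
    plus-minus : ∀ i → i ≡ (1ℤ ℤ.+ i) ℤ.- 1ℤ
    plus-minus = solve-∀
    one-square : ∀ x → ∑ (λ y → 𝟙 (x * x ≟ y)) ≡ 1ℤ
    one-square x = trans (∑-cong (λ y → 𝟙-cong (x * x ≟ y) (y ≟ x * x) sym sym)) (∑-𝟙≡ (x * x))

  square-* : ∀ {a x} → IsSquare a → IsSquare x → IsSquare (a * x)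
  square-* {a} {x} (z , z²≡a) (w , w²≡x) =
    z * w , trans (solve 2 (λ z w → (z :* w) :* (z :* w) := (z :* z) :* (w :* w)) refl z w) (cong₂ _*_ z²≡a w²≡x)

  square-cancelˡ : ∀ {a x} → IsSquare a → a ≢ 0# → IsSquare (a * x) → IsSquare x
  square-cancelˡ {a} {x} (z , z²≡a) a≢0 (w , w²≡ax) = w * z ⁻¹ , (begin
    (w * z ⁻¹) * (w * z ⁻¹)          ≡⟨ solve 3 (λ w z i → (w :* i) :* (w :* i) := (w :* w) :* (i :* i)) refl w z (z ⁻¹) ⟩
    (w * w) * (z ⁻¹ * z ⁻¹)          ≡⟨ cong (_* (z ⁻¹ * z ⁻¹)) (trans w²≡ax (cong (_* x) (sym z²≡a))) ⟩
    ((z * z) * x) * (z ⁻¹ * z ⁻¹)    ≡⟨ solve 3 (λ z x i → ((z :* z) :* x) :* (i :* i) := x :* ((z :* i) :* (z :* i))) refl z x (z ⁻¹) ⟩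
    x * ((z * z ⁻¹) * (z * z ⁻¹))    ≡⟨ cong (λ t → x * (t * t)) (x*x⁻¹≡1 z≢0) ⟩
    x * (1# * 1#)                    ≡⟨ solve 1 (λ x → x :* (con (ℤ.+ 1) :* con (ℤ.+ 1)) := x) refl x ⟩
    x                                ∎)
    where
    z≢0 : z ≢ 0#
    z≢0 refl = a≢0 (trans (sym z²≡a) (zeroˡ 0#))

  χ-*-square : ∀ {a} x → a ≢ 0# → IsSquare a → χ (a * x) ≡ χ x
  χ-*-square {a} x a≢0 □a with residue x
  ... | zero x≡0      = trans (χ-zero (trans (cong (a *_) x≡0) (zeroʳ a))) (sym (χ-zero x≡0))
  ... | square x≢0 □x = trans (χ-square (*-≢0 a≢0 x≢0) (square-* □a □x)) (sym (χ-square x≢0 □x))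
  ... | nonsquare ¬□x = trans (χ-nonsquare (λ □ax → ¬□x (square-cancelˡ □a a≢0 □ax))) (sym (χ-nonsquare ¬□x))

  ∑χ-scaled : ∀ {a} → a ≢ 0# → ∑ (λ x → χ (a * x)) ≡ 0ℤ
  ∑χ-scaled {a} a≢0 = trans (∑-permute (a *_) (a ⁻¹ *_) (λ x → x*[x⁻¹*y]≡y x a≢0) (λ x → x⁻¹*[x*y]≡y x a≢0) χ) ∑χ≡0

  -- χ (a x) + χ x ≤ 0 for every x, and these terms sum to 0, so each vanishes.
  χ-*-nonsquare : ∀ {a} x → ¬ IsSquare a → χ (a * x) ≡ ℤ.- χ x
  χ-*-nonsquare {a} x ¬□a = begin
    χ (a * x)                          ≡⟨ plus-minus (χ (a * x)) (χ x) ⟩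
    (χ (a * x) ℤ.+ χ x) ℤ.- χ x        ≡⟨ cong (ℤ._- χ x) (nonpos-∑≡0⇒≡0 pair pair≤0 ∑pair≡0 x) ⟩
    0ℤ ℤ.- χ x                         ≡⟨ ℤP.+-identityˡ (ℤ.- χ x) ⟩
    ℤ.- χ x                            ∎
    where
    a≢0 = nonsquare-≢0 ¬□a
    plus-minus : ∀ i j → i ≡ (i ℤ.+ j) ℤ.- j
    plus-minus = solve-∀
    pair : F → ℤ
    pair y = χ (a * y) ℤ.+ χ y
    χ≤1 : ∀ y → χ y ℤ.≤ 1ℤ
    χ≤1 y = ℤP.≤-trans (i≤+∣i∣ (χ y)) (ℤ.+≤+ (∣χ∣≤1 y))
    pair≤0 : ∀ y → pair y ℤ.≤ 0ℤ
    pair≤0 y with residue y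
    ... | zero y≡0      = ℤP.≤-reflexive (cong₂ ℤ._+_ (χ-zero (trans (cong (a *_) y≡0) (zeroʳ a))) (χ-zero y≡0))
    ... | square y≢0 □y = ℤP.≤-reflexive (cong₂ ℤ._+_ (χ-nonsquare ¬□ay) (χ-square y≢0 □y))
      where
      ¬□ay : ¬ IsSquare (a * y)
      ¬□ay □ay = ¬□a (square-cancelˡ □y y≢0 (subst IsSquare (*-comm a y) □ay))
    ... | nonsquare ¬□y = ℤP.≤-trans (ℤP.+-mono-≤ (χ≤1 (a * y)) (ℤP.≤-reflexive (χ-nonsquare ¬□y))) ℤP.≤-refl
    ∑pair≡0 : ∑ pair ≡ 0ℤ
    ∑pair≡0 = trans (∑-+ (λ y → χ (a * y)) χ) (cong₂ ℤ._+_ (∑χ-scaled a≢0) ∑χ≡0)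

  χ-* : ∀ a x → χ (a * x) ≡ χ a ℤ.* χ x
  χ-* a x with residue a
  ... | zero a≡0      = trans (χ-zero (trans (cong (_* x) a≡0) (zeroˡ x))) (sym (trans (cong (ℤ._* χ x) (χ-zero a≡0)) (ℤP.*-zeroˡ (χ x))))
  ... | square a≢0 □a = trans (χ-*-square x a≢0 □a) (sym (trans (cong (ℤ._* χ x) (χ-square a≢0 □a)) (ℤP.*-identityˡ (χ x))))
  ... | nonsquare ¬□a = trans (χ-*-nonsquare x ¬□a) (sym (trans (cong (ℤ._* χ x) (χ-nonsquare ¬□a)) (ℤP.-1*i≡-i (χ x))))

  2·𝟙square-1≡χ+𝟙zero : ∀ x → ℤ.+ 2 ℤ.* 𝟙 (isSquare? x) ℤ.- 1ℤ ≡ χ x ℤ.+ 𝟙 (x ≟ 0#)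
  2·𝟙square-1≡χ+𝟙zero x with residue x
  ... | zero x≡0 = trans (cong (λ i → ℤ.+ 2 ℤ.* i ℤ.- 1ℤ) (𝟙-yes (isSquare? x) (0# , trans (zeroˡ 0#) (sym x≡0))))
                         (sym (cong₂ ℤ._+_ (χ-zero x≡0) (𝟙-yes (x ≟ 0#) x≡0)))
  ... | square x≢0 □x = trans (cong (λ i → ℤ.+ 2 ℤ.* i ℤ.- 1ℤ) (𝟙-yes (isSquare? x) □x))
                              (sym (cong₂ ℤ._+_ (χ-square x≢0 □x) (𝟙-no (x ≟ 0#) x≢0)))
  ... | nonsquare ¬□x = trans (cong (λ i → ℤ.+ 2 ℤ.* i ℤ.- 1ℤ) (𝟙-no (isSquare? x) ¬□x))
                              (sym (cong₂ ℤ._+_ (χ-nonsquare ¬□x) (𝟙-no (x ≟ 0#) (nonsquare-≢0 ¬□x))))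

module CharacterSums {q : ℕ} (𝔽 : FiniteField q) (q-odd : q ℕ.% 2 ≡ 1) where

  open import Data.Integer as ℤ using (ℤ; 0ℤ; 1ℤ; -1ℤ)
  import Data.Integer.Properties as ℤP
  open import Data.Product using (∃; _×_; _,_)
  open import Data.Empty using (⊥-elim)
  open import Relation.Binary.PropositionalEquality
  open import Relation.Nullary using (¬_; Dec; yes; no)
  open import Function using (_∘_)
  open IntegerSums
  open QuadraticCharacter 𝔽 q-odd public
  open FiniteField 𝔽 using (0≢1)
  open ≡-Reasoning

  ∑χ-linear : ∀ {A} B → A ≢ 0# → ∑ (λ u → χ (A * u + B)) ≡ 0ℤ
  ∑χ-linear {A} B A≢0 = trans (∑-permute affine affine⁻¹ inverseʳ inverseˡ χ) ∑χ≡0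
    where
    affine affine⁻¹ : F → F
    affine u   = A * u + B
    affine⁻¹ w = A ⁻¹ * (w + - B)
    inverseʳ : ∀ w → affine (affine⁻¹ w) ≡ w
    inverseʳ w = begin
      A * (A ⁻¹ * (w + - B)) + B  ≡⟨ cong (_+ B) (x*[x⁻¹*y]≡y (w + - B) A≢0) ⟩
      (w + - B) + B               ≡⟨ solve 2 (λ w B → (w :- B) :+ B := w) refl w B ⟩
      w                           ∎
    inverseˡ : ∀ u → affine⁻¹ (affine u) ≡ u
    inverseˡ u = begin
      A ⁻¹ * ((A * u + B) + - B)  ≡⟨ cong (A ⁻¹ *_) (solve 2 (λ x B → (x :+ B) :- B := x) refl (A * u) B) ⟩
      A ⁻¹ * (A * u)              ≡⟨ x⁻¹*[x*y]≡y u A≢0 ⟩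
      u                           ∎

  χ1≡1 : χ 1# ≡ 1ℤ
  χ1≡1 = χ-square (λ 1≡0 → 0≢1 (sym 1≡0)) (1# , *-identityˡ 1#)

  -- For u ≢ 0, (u + r) u = u² (1 + r u⁻¹); the junk value 0⁻¹ = 0 makes u ↦ 1 + r u⁻¹ a bijection.
  ∑χ-[u+r]u : ∀ {r} → r ≢ 0# → ∑ (λ u → χ ((u + r) * u)) ≡ -1ℤ
  ∑χ-[u+r]u {r} r≢0 = begin
    ∑ (λ u → χ ((u + r) * u))                  ≡⟨ ∑-cong χ-[u+r]u ⟩
    ∑ (λ u → χ (σ u) ℤ.- 𝟙 (u ≟ 0#))           ≡⟨ ∑-sub (χ ∘ σ) (λ u → 𝟙 (u ≟ 0#)) ⟩
    ∑ (χ ∘ σ) ℤ.- ∑ (λ u → 𝟙 (u ≟ 0#))         ≡⟨ cong₂ ℤ._-_ (trans (∑-permute σ σ⁻¹ inverseʳ inverseˡ χ) ∑χ≡0) (∑-𝟙≡ 0#) ⟩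
    -1ℤ                                        ∎
    where
    σ σ⁻¹ : F → F
    σ u   = 1# + r * u ⁻¹
    σ⁻¹ w = (r ⁻¹ * (w + - 1#)) ⁻¹
    inverseʳ : ∀ w → σ (σ⁻¹ w) ≡ w
    inverseʳ w = begin
      1# + r * (r ⁻¹ * (w + - 1#)) ⁻¹ ⁻¹   ≡⟨ cong (λ t → 1# + r * t) (⁻¹-involutive _) ⟩
      1# + r * (r ⁻¹ * (w + - 1#))         ≡⟨ cong (1# +_) (x*[x⁻¹*y]≡y (w + - 1#) r≢0) ⟩
      1# + (w + - 1#)                      ≡⟨ solve 1 (λ w → con (ℤ.+ 1) :+ (w :- con (ℤ.+ 1)) := w) refl w ⟩
      w                                    ∎
    inverseˡ : ∀ u → σ⁻¹ (σ u) ≡ u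
    inverseˡ u = begin
      (r ⁻¹ * ((1# + r * u ⁻¹) + - 1#)) ⁻¹  ≡⟨ cong (λ t → (r ⁻¹ * t) ⁻¹) (solve 1 (λ x → (con (ℤ.+ 1) :+ x) :- con (ℤ.+ 1) := x) refl (r * u ⁻¹)) ⟩
      (r ⁻¹ * (r * u ⁻¹)) ⁻¹                ≡⟨ cong _⁻¹ (x⁻¹*[x*y]≡y (u ⁻¹) r≢0) ⟩
      u ⁻¹ ⁻¹                               ≡⟨ ⁻¹-involutive u ⟩
      u                                     ∎
    χ-[u+r]u : ∀ u → χ ((u + r) * u) ≡ χ (σ u) ℤ.- 𝟙 (u ≟ 0#)
    χ-[u+r]u u = by-cases (u ≟ 0#)
      where
      by-cases : Dec (u ≡ 0#) → χ ((u + r) * u) ≡ χ (σ u) ℤ.- 𝟙 (u ≟ 0#)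
      by-cases (yes refl) = begin
        χ ((0# + r) * 0#)            ≡⟨ χ-zero (zeroʳ (0# + r)) ⟩
        1ℤ ℤ.- 1ℤ                    ≡⟨ cong₂ ℤ._-_ (trans (cong χ σ0≡1) χ1≡1) (𝟙-yes (0# ≟ 0#) refl) ⟨
        χ (σ 0#) ℤ.- 𝟙 (0# ≟ 0#)     ∎
        where
        σ0≡1 : σ 0# ≡ 1#
        σ0≡1 = trans (cong (λ t → 1# + r * t) 0⁻¹≡0) (trans (cong (1# +_) (zeroʳ r)) (+-identityʳ 1#))
      by-cases (no u≢0) = begin
        χ ((u + r) * u)                 ≡⟨ cong χ (begin
          (u + r) * u                          ≡⟨ solve 2 (λ u r → (u :+ r) :* u := u :* u :+ r :* u :* con (ℤ.+ 1)) refl u r ⟩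
          u * u + r * u * 1#                   ≡⟨ cong (λ t → u * u + r * u * t) (x*x⁻¹≡1 u≢0) ⟨
          u * u + r * u * (u * u ⁻¹)           ≡⟨ solve 3 (λ u r i → u :* u :+ r :* u :* (u :* i) := (u :* u) :* (con (ℤ.+ 1) :+ r :* i)) refl u r (u ⁻¹) ⟩
          (u * u) * σ u                        ∎) ⟩
        χ ((u * u) * σ u)               ≡⟨ χ-*-square (σ u) (*-≢0 u≢0 u≢0) (u , refl) ⟩
        χ (σ u)                         ≡⟨ ℤP.+-identityʳ (χ (σ u)) ⟨
        χ (σ u) ℤ.- 0ℤ                  ≡⟨ cong (ℤ._-_ (χ (σ u))) (𝟙-no (u ≟ 0#) u≢0) ⟨
        χ (σ u) ℤ.- 𝟙 (u ≟ 0#)          ∎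

  ∑χ-[u+r₁][u+r₂] : ∀ {r₁ r₂} → r₁ + - r₂ ≢ 0# → ∑ (λ u → χ ((u + r₁) * (u + r₂))) ≡ -1ℤ
  ∑χ-[u+r₁][u+r₂] {r₁} {r₂} r₁-r₂≢0 = begin
    ∑ (λ u → χ ((u + r₁) * (u + r₂)))                     ≡⟨ ∑-permute (_+ - r₂) (_+ r₂) cancel₁ cancel₂ _ ⟨
    ∑ (λ u → χ (((u + - r₂) + r₁) * ((u + - r₂) + r₂)))   ≡⟨ ∑-cong (λ u → cong χ (regroup u)) ⟩
    ∑ (λ u → χ ((u + (r₁ + - r₂)) * u))                   ≡⟨ ∑χ-[u+r]u r₁-r₂≢0 ⟩
    -1ℤ                                                   ∎
    where
    cancel₁ : ∀ u → (u + r₂) + - r₂ ≡ u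
    cancel₁ u = solve 2 (λ u r → (u :+ r) :- r := u) refl u r₂
    cancel₂ : ∀ u → (u + - r₂) + r₂ ≡ u
    cancel₂ u = solve 2 (λ u r → (u :- r) :+ r := u) refl u r₂
    regroup : ∀ u → ((u + - r₂) + r₁) * ((u + - r₂) + r₂) ≡ (u + (r₁ + - r₂)) * u
    regroup u = solve 3 (λ u r₁ r₂ → ((u :- r₂) :+ r₁) :* ((u :- r₂) :+ r₂) := (u :+ (r₁ :- r₂)) :* u) refl u r₁ r₂

  ∑χ-linear-pair : ∀ {A₁ A₂} B₁ B₂ → A₁ ≢ 0# → A₂ ≢ 0# → A₁ * B₂ + - (A₂ * B₁) ≢ 0# →
                   ∑ (λ u → χ (A₁ * u + B₁) ℤ.* χ (A₂ * u + B₂)) ≡ ℤ.- χ (A₁ * A₂)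
  ∑χ-linear-pair {A₁} {A₂} B₁ B₂ A₁≢0 A₂≢0 det≢0 = begin
    ∑ (λ u → χ (A₁ * u + B₁) ℤ.* χ (A₂ * u + B₂))            ≡⟨ ∑-cong factor ⟩
    ∑ (λ u → χ (A₁ * A₂) ℤ.* χ ((u + r₁) * (u + r₂)))        ≡⟨ ∑-*ˡ (χ (A₁ * A₂)) _ ⟩
    χ (A₁ * A₂) ℤ.* ∑ (λ u → χ ((u + r₁) * (u + r₂)))        ≡⟨ cong (χ (A₁ * A₂) ℤ.*_) (∑χ-[u+r₁][u+r₂] r₁-r₂≢0) ⟩
    χ (A₁ * A₂) ℤ.* -1ℤ                                      ≡⟨ trans (ℤP.*-comm _ -1ℤ) (ℤP.-1*i≡-i _) ⟩
    ℤ.- χ (A₁ * A₂)                                          ∎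
    where
    r₁ = A₁ ⁻¹ * B₁
    r₂ = A₂ ⁻¹ * B₂
    B₁≡A₁r₁ : B₁ ≡ A₁ * r₁
    B₁≡A₁r₁ = sym (x*[x⁻¹*y]≡y B₁ A₁≢0)
    B₂≡A₂r₂ : B₂ ≡ A₂ * r₂
    B₂≡A₂r₂ = sym (x*[x⁻¹*y]≡y B₂ A₂≢0)
    r₁-r₂≢0 : r₁ + - r₂ ≢ 0#
    r₁-r₂≢0 r₁-r₂≡0 = det≢0 (begin
      A₁ * B₂ + - (A₂ * B₁)                 ≡⟨ cong₂ (λ s t → A₁ * s + - (A₂ * t)) B₂≡A₂r₂ B₁≡A₁r₁ ⟩
      A₁ * (A₂ * r₂) + - (A₂ * (A₁ * r₁))   ≡⟨ solve 4 (λ A₁ A₂ r₁ r₂ → A₁ :* (A₂ :* r₂) :- A₂ :* (A₁ :* r₁) := :- ((A₁ :* A₂) :* (r₁ :- r₂))) refl A₁ A₂ r₁ r₂ ⟩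
      - ((A₁ * A₂) * (r₁ + - r₂))           ≡⟨ cong (λ t → - ((A₁ * A₂) * t)) r₁-r₂≡0 ⟩
      - ((A₁ * A₂) * 0#)                    ≡⟨ cong -_ (zeroʳ (A₁ * A₂)) ⟩
      - 0#                                  ≡⟨ -0#≈0# ⟩
      0#                                    ∎)
    factor : ∀ u → χ (A₁ * u + B₁) ℤ.* χ (A₂ * u + B₂) ≡ χ (A₁ * A₂) ℤ.* χ ((u + r₁) * (u + r₂))
    factor u = begin
      χ (A₁ * u + B₁) ℤ.* χ (A₂ * u + B₂)            ≡⟨ χ-* _ _ ⟨
      χ ((A₁ * u + B₁) * (A₂ * u + B₂))              ≡⟨ cong χ (cong₂ (λ s t → (A₁ * u + s) * (A₂ * u + t)) B₁≡A₁r₁ B₂≡A₂r₂) ⟩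
      χ ((A₁ * u + A₁ * r₁) * (A₂ * u + A₂ * r₂))    ≡⟨ cong χ (solve 5 (λ A₁ A₂ u r₁ r₂ → (A₁ :* u :+ A₁ :* r₁) :* (A₂ :* u :+ A₂ :* r₂) := (A₁ :* A₂) :* ((u :+ r₁) :* (u :+ r₂))) refl A₁ A₂ u r₁ r₂) ⟩
      χ ((A₁ * A₂) * ((u + r₁) * (u + r₂)))          ≡⟨ χ-* _ _ ⟩
      χ (A₁ * A₂) ℤ.* χ ((u + r₁) * (u + r₂))        ∎

  private
    ≡0⇒∣∣≤1 : ∀ {s} → s ≡ 0ℤ → ℤ.∣ s ∣ ℕ.≤ 1
    ≡0⇒∣∣≤1 refl = ℕ.z≤n

  ∣∑χ-linear-pair∣≤1 : ∀ A₁ B₁ A₂ B₂ → A₁ * B₂ + - (A₂ * B₁) ≢ 0# →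
                       ℤ.∣ ∑ (λ u → χ (A₁ * u + B₁) ℤ.* χ (A₂ * u + B₂)) ∣ ℕ.≤ 1
  ∣∑χ-linear-pair∣≤1 A₁ B₁ A₂ B₂ det≢0 with A₁ ≟ 0# | A₂ ≟ 0#
  ... | yes refl | yes refl = ⊥-elim (det≢0 (solve 2 (λ B₁ B₂ → con (ℤ.+ 0) :* B₂ :- con (ℤ.+ 0) :* B₁ := con (ℤ.+ 0)) refl B₁ B₂))
  ... | yes refl | no A₂≢0 = ≡0⇒∣∣≤1 (begin
    ∑ (λ u → χ (0# * u + B₁) ℤ.* χ (A₂ * u + B₂))  ≡⟨ ∑-cong (λ u → cong (λ t → χ t ℤ.* χ (A₂ * u + B₂)) (constant u)) ⟩
    ∑ (λ u → χ B₁ ℤ.* χ (A₂ * u + B₂))            ≡⟨ ∑-*ˡ (χ B₁) _ ⟩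
    χ B₁ ℤ.* ∑ (λ u → χ (A₂ * u + B₂))            ≡⟨ cong (χ B₁ ℤ.*_) (∑χ-linear B₂ A₂≢0) ⟩
    χ B₁ ℤ.* 0ℤ                                   ≡⟨ ℤP.*-zeroʳ (χ B₁) ⟩
    0ℤ                                            ∎)
    where
    constant : ∀ u → 0# * u + B₁ ≡ B₁
    constant u = solve 2 (λ u B → con (ℤ.+ 0) :* u :+ B := B) refl u B₁
  ... | no A₁≢0 | yes refl = ≡0⇒∣∣≤1 (begin
    ∑ (λ u → χ (A₁ * u + B₁) ℤ.* χ (0# * u + B₂))  ≡⟨ ∑-cong (λ u → cong (λ t → χ (A₁ * u + B₁) ℤ.* χ t) (constant u)) ⟩
    ∑ (λ u → χ (A₁ * u + B₁) ℤ.* χ B₂)            ≡⟨ ∑-*ʳ (χ B₂) _ ⟩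
    ∑ (λ u → χ (A₁ * u + B₁)) ℤ.* χ B₂            ≡⟨ cong (ℤ._* χ B₂) (∑χ-linear B₁ A₁≢0) ⟩
    0ℤ ℤ.* χ B₂                                   ≡⟨ ℤP.*-zeroˡ (χ B₂) ⟩
    0ℤ                                            ∎)
    where
    constant : ∀ u → 0# * u + B₂ ≡ B₂
    constant u = solve 2 (λ u B → con (ℤ.+ 0) :* u :+ B := B) refl u B₂
  ... | no A₁≢0 | no A₂≢0 = subst (λ s → ℤ.∣ s ∣ ℕ.≤ 1) (sym (∑χ-linear-pair B₁ B₂ A₁≢0 A₂≢0 det≢0))
                              (subst (ℕ._≤ 1) (sym (ℤP.∣-i∣≡∣i∣ (χ (A₁ * A₂)))) (∣χ∣≤1 (A₁ * A₂)))

  ∑χ²≤q : ∀ (f : F → F) → ∑ (λ u → sq (χ (f u))) ℤ.≤ ℤ.+ q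
  ∑χ²≤q f = ℤP.≤-trans (∑-mono (λ u → ∣i∣≤1⇒sq≤1 (χ (f u)) (∣χ∣≤1 (f u))))
                       (ℤP.≤-reflexive (trans (∑-const 1ℤ) (ℤP.*-identityʳ (ℤ.+ q))))

  -- The bilinear polynomial a x y + b x + c y + e with a e ≠ b c.
  record Nondegenerate : Set where
    field
      a b c e : F
      Δ≢0     : a * e + - (b * c) ≢ 0#

  module BilinearCharacter (form : Nondegenerate) where

    open Nondegenerate form

    bilinear : F → F → F
    bilinear u v = a * u * v + b * u + c * v + e

    χ-bilinear : F → F → ℤ
    χ-bilinear u v = χ (bilinear u v)

    bilinear-linear-in-u : ∀ u v → bilinear u v ≡ (a * v + b) * u + (c * v + e)
    bilinear-linear-in-u u v = solve 6 (λ a b c e u v → a :* u :* v :+ b :* u :+ c :* v :+ e := (a :* v :+ b) :* u :+ (c :* v :+ e)) refl a b c e u v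

    bilinear-linear-in-v : ∀ u v → bilinear u v ≡ (a * u + c) * v + (b * u + e)
    bilinear-linear-in-v u v = solve 6 (λ a b c e u v → a :* u :* v :+ b :* u :+ c :* v :+ e := (a :* u :+ c) :* v :+ (b :* u :+ e)) refl a b c e u v

    columns-nearly-orthogonal : ∀ v₁ v₂ → v₁ ≢ v₂ → ℤ.∣ ∑ (λ u → χ-bilinear u v₁ ℤ.* χ-bilinear u v₂) ∣ ℕ.≤ 1
    columns-nearly-orthogonal v₁ v₂ v₁≢v₂ =
      subst (λ s → ℤ.∣ s ∣ ℕ.≤ 1) (∑-cong (λ u → sym (cong₂ (λ s t → χ s ℤ.* χ t) (bilinear-linear-in-u u v₁) (bilinear-linear-in-u u v₂))))
        (∣∑χ-linear-pair∣≤1 (a * v₁ + b) (c * v₁ + e) (a * v₂ + b) (c * v₂ + e) det≢0)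
      where
      det≢0 : (a * v₁ + b) * (c * v₂ + e) + - ((a * v₂ + b) * (c * v₁ + e)) ≢ 0#
      det≢0 det≡0 = *-≢0 Δ≢0 (v₁≢v₂ ∘ x∙y⁻¹≈ε⇒x≈y v₁ v₂) (begin
        (a * e + - (b * c)) * (v₁ + - v₂)                               ≡⟨ solve 6 (λ a b c e v₁ v₂ →
           (a :* e :- b :* c) :* (v₁ :- v₂) := (a :* v₁ :+ b) :* (c :* v₂ :+ e) :- (a :* v₂ :+ b) :* (c :* v₁ :+ e)) refl a b c e v₁ v₂ ⟩
        (a * v₁ + b) * (c * v₂ + e) + - ((a * v₂ + b) * (c * v₁ + e))   ≡⟨ det≡0 ⟩
        0#                                                              ∎)

    private
      not-both-0 : ∀ {A B} k → a * e + - (b * c) ≡ a * B + - (k * A) → ¬ (A ≡ 0# × B ≡ 0#)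
      not-both-0 {A} {B} k Δ≡ (A≡0 , B≡0) = Δ≢0 (begin
        a * e + - (b * c)    ≡⟨ Δ≡ ⟩
        a * B + - (k * A)    ≡⟨ cong₂ (λ x y → a * x + - (k * y)) B≡0 A≡0 ⟩
        a * 0# + - (k * 0#)  ≡⟨ solve 2 (λ a k → a :* con (ℤ.+ 0) :- k :* con (ℤ.+ 0) := con (ℤ.+ 0)) refl a k ⟩
        0#                   ∎)

    unique-root-v : ∀ u → ∃ λ r → ∀ v → bilinear u v ≡ 0# → v ≡ r
    unique-root-v u with linear-root-unique {a * u + c} {b * u + e}
                           (not-both-0 b (solve 5 (λ a b c e u → a :* e :- b :* c := a :* (b :* u :+ e) :- b :* (a :* u :+ c)) refl a b c e u))
    ... | r , root≡r = r , λ v root → root≡r v (trans (sym (bilinear-linear-in-v u v)) root)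

    unique-root-u : ∀ v → ∃ λ r → ∀ u → bilinear u v ≡ 0# → u ≡ r
    unique-root-u v with linear-root-unique {a * v + b} {c * v + e}
                           (not-both-0 c (solve 5 (λ a b c e v → a :* e :- b :* c := a :* (c :* v :+ e) :- c :* (a :* v :+ b)) refl a b c e v))
    ... | r , root≡r = r , λ u root → root≡r u (trans (sym (bilinear-linear-in-u u v)) root)

    open BilinearBound χ-bilinear (λ v → ∑χ²≤q (λ u → bilinear u v)) columns-nearly-orthogonal public
      using (bilinear-bound)

module Polynomials {q : ℕ} (𝔽 : FiniteField q) where

  open import Data.Nat as ℕ using (ℕ; zero; suc)
  import Data.Nat.Properties as ℕP
  import Data.Fin.Properties as FinP
  open import Data.Integer as ℤ using (ℤ; 1ℤ)
  import Data.Integer.Properties as ℤP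
  open import Data.Product using (_,_)
  open import Data.Sum using (_⊎_; inj₁; inj₂)
  import Data.Sum
  open import Relation.Binary.PropositionalEquality
  open import Relation.Nullary using (yes; no)
  open import Function using (_∘_; id)
  open IntegerSums
  open FieldFacts 𝔽
  open FF 𝔽 using (sumTo; _^_; Poly; evalP; HasDegree; Poly2; evalP2; DegX1; DegY1)

  sumTo-cong : ∀ n {φ ψ : ℕ → F} → (∀ i → φ i ≡ ψ i) → sumTo n φ ≡ sumTo n ψ
  sumTo-cong zero    φ≗ψ = φ≗ψ 0
  sumTo-cong (suc n) φ≗ψ = cong₂ _+_ (sumTo-cong n φ≗ψ) (φ≗ψ (suc n))

  sumTo-zero : ∀ n {φ : ℕ → F} → (∀ i → i ℕ.≤ n → φ i ≡ 0#) → sumTo n φ ≡ 0#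
  sumTo-zero zero    φ≡0 = φ≡0 0 ℕ.z≤n
  sumTo-zero (suc n) φ≡0 = trans (cong₂ _+_ (sumTo-zero n (λ i i≤n → φ≡0 i (ℕP.m≤n⇒m≤1+n i≤n))) (φ≡0 (suc n) ℕP.≤-refl)) (+-identityʳ 0#)

  sumTo-truncate : ∀ {m} n {φ : ℕ → F} → m ℕ.≤ n → (∀ i → m ℕ.< i → i ℕ.≤ n → φ i ≡ 0#) → sumTo n φ ≡ sumTo m φ
  sumTo-truncate zero    ℕ.z≤n _ = refl
  sumTo-truncate {m} (suc n) {φ} m≤1+n φ≡0 with ℕP.m≤n⇒m<n∨m≡n m≤1+n
  ... | inj₂ refl = refl
  ... | inj₁ m<1+n@(ℕ.s≤s m≤n) = begin
    sumTo n φ + φ (suc n)  ≡⟨ cong₂ _+_ (sumTo-truncate n m≤n (λ i m<i i≤n → φ≡0 i m<i (ℕP.m≤n⇒m≤1+n i≤n))) (φ≡0 (suc n) m<1+n ℕP.≤-refl) ⟩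
    sumTo m φ + 0#         ≡⟨ +-identityʳ (sumTo m φ) ⟩
    sumTo m φ              ∎
    where open ≡-Reasoning

  sumTo-last : ∀ m {φ : ℕ → F} → (∀ i → i ℕ.< m → φ i ≡ 0#) → sumTo m φ ≡ φ m
  sumTo-last zero    _   = refl
  sumTo-last (suc m) {φ} φ≡0 = trans (cong (_+ φ (suc m)) (sumTo-zero m (λ i i≤m → φ≡0 i (ℕ.s≤s i≤m)))) (+-identityˡ (φ (suc m)))

  sumTo-single : ∀ {m} n {φ : ℕ → F} → m ℕ.≤ n → (∀ i → i ℕ.≤ n → i ≢ m → φ i ≡ 0#) → sumTo n φ ≡ φ m
  sumTo-single {m} n m≤n φ≡0 =
    trans (sumTo-truncate n m≤n (λ i m<i i≤n → φ≡0 i i≤n (ℕP.<⇒≢ m<i ∘ sym)))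
          (sumTo-last m (λ i i<m → φ≡0 i (ℕP.≤-trans (ℕP.<⇒≤ i<m) m≤n) (ℕP.<⇒≢ i<m)))

  evalP2-bidegree11 : ∀ (f : Poly2) → DegX1 f → DegY1 f → let open Poly2 f in
    ∀ u v → evalP2 f u v ≡ coeff 1 1 * u * v + coeff 1 0 * u + coeff 0 1 * v + coeff 0 0
  evalP2-bidegree11 f (x-deg≤1 , j , f1j≢0) (y-deg≤1 , _) u v = begin
    evalP2 f u v                     ≡⟨ sumTo-truncate bound 1≤bound (λ i 1<i _ → sumTo-zero bound (λ j _ → vanishes-x i j 1<i)) ⟩
    row 0 + row 1                    ≡⟨ cong₂ _+_ (sumTo-truncate bound 1≤bound (λ j 1<j _ → vanishes-y 0 j 1<j))
                                                  (sumTo-truncate bound 1≤bound (λ j 1<j _ → vanishes-y 1 j 1<j)) ⟩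
    (coeff 0 0 * (1# * 1#) + coeff 0 1 * (1# * (v * 1#))) + (coeff 1 0 * ((u * 1#) * 1#) + coeff 1 1 * ((u * 1#) * (v * 1#)))
                                     ≡⟨ solve 6 (λ e c b a u v →
                                          (e :* (one :* one) :+ c :* (one :* (v :* one))) :+ (b :* ((u :* one) :* one) :+ a :* ((u :* one) :* (v :* one)))
                                          := a :* u :* v :+ b :* u :+ c :* v :+ e) refl (coeff 0 0) (coeff 0 1) (coeff 1 0) (coeff 1 1) u v ⟩
    coeff 1 1 * u * v + coeff 1 0 * u + coeff 0 1 * v + coeff 0 0 ∎
    where
    open ≡-Reasoning
    open Poly2 f
    one = con (ℤ.+ 1)
    term : ℕ → ℕ → F
    term i j = coeff i j * ((u ^ i) * (v ^ j))
    row : ℕ → F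
    row i = sumTo bound (term i)
    1≤bound : 1 ℕ.≤ bound
    1≤bound = ℕP.≮⇒≥ (λ bound<1 → f1j≢0 (vanish 1 j (inj₁ bound<1)))
    vanishes-x : ∀ i j → 1 ℕ.< i → term i j ≡ 0#
    vanishes-x i j 1<i = trans (cong (_* ((u ^ i) * (v ^ j))) (x-deg≤1 i j 1<i)) (zeroˡ _)
    vanishes-y : ∀ i j → 1 ℕ.< j → term i j ≡ 0#
    vanishes-y i j 1<j = trans (cong (_* ((u ^ i) * (v ^ j))) (y-deg≤1 i j 1<j)) (zeroˡ _)

  poly : ℕ → (ℕ → F) → F → F
  poly n c s = sumTo n (λ i → c i * (s ^ i))

  horner : ∀ n c s → poly (suc n) c s ≡ c 0 + s * poly n (c ∘ suc) s
  horner zero c s =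
    solve 3 (λ c₀ c₁ s → c₀ :* con (ℤ.+ 1) :+ c₁ :* (s :* con (ℤ.+ 1)) := c₀ :+ s :* (c₁ :* con (ℤ.+ 1))) refl (c 0) (c 1) s
  horner (suc n) c s = begin
    poly (suc n) c s + c (suc (suc n)) * (s * (s ^ suc n))        ≡⟨ cong (_+ c (suc (suc n)) * (s * (s ^ suc n))) (horner n c s) ⟩
    (c 0 + s * poly n (c ∘ suc) s) + c (suc (suc n)) * (s * (s ^ suc n))
      ≡⟨ solve 5 (λ c₀ s p k t → (c₀ :+ s :* p) :+ k :* (s :* t) := c₀ :+ s :* (p :+ k :* t)) refl (c 0) s (poly n (c ∘ suc) s) (c (suc (suc n))) (s ^ suc n) ⟩
    c 0 + s * (poly n (c ∘ suc) s + c (suc (suc n)) * (s ^ suc n)) ∎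
    where open ≡-Reasoning

  -- Coefficients of the quotient of a degree-(n+1) polynomial by (x - r).
  quotient : ℕ → (ℕ → F) → F → ℕ → F
  quotient zero    c r _       = c 1
  quotient (suc n) c r zero    = poly (suc n) (c ∘ suc) r
  quotient (suc n) c r (suc i) = quotient n (c ∘ suc) r i

  quotient-leading : ∀ n c r → quotient n c r n ≡ c (suc n)
  quotient-leading zero    c r = refl
  quotient-leading (suc n) c r = quotient-leading n (c ∘ suc) r

  synthetic-division : ∀ n c r s → poly (suc n) c s ≡ (s + - r) * poly n (quotient n c r) s + poly (suc n) c r
  synthetic-division zero c r s = begin
    poly 1 c s                                        ≡⟨ horner zero c s ⟩
    c 0 + s * (c 1 * 1#)                              ≡⟨ solve 4 (λ c₀ c₁ s r → c₀ :+ s :* (c₁ :* con (ℤ.+ 1))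
                                                           := (s :- r) :* (c₁ :* con (ℤ.+ 1)) :+ (c₀ :+ r :* (c₁ :* con (ℤ.+ 1)))) refl (c 0) (c 1) s r ⟩
    (s + - r) * (c 1 * 1#) + (c 0 + r * (c 1 * 1#))   ≡⟨ cong ((s + - r) * (c 1 * 1#) +_) (horner zero c r) ⟨
    (s + - r) * (c 1 * 1#) + poly 1 c r               ∎
    where open ≡-Reasoning
  synthetic-division (suc n) c r s = begin
    poly (suc (suc n)) c s                                            ≡⟨ horner (suc n) c s ⟩
    c 0 + s * poly (suc n) (c ∘ suc) s                                ≡⟨ cong (λ t → c 0 + s * t) (synthetic-division n (c ∘ suc) r s) ⟩
    c 0 + s * ((s + - r) * poly n q′ s + poly (suc n) (c ∘ suc) r)
      ≡⟨ solve 5 (λ c₀ s r p₁ p₂ → c₀ :+ s :* ((s :- r) :* p₁ :+ p₂) := (s :- r) :* (p₂ :+ s :* p₁) :+ (c₀ :+ r :* p₂))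
               refl (c 0) s r (poly n q′ s) (poly (suc n) (c ∘ suc) r) ⟩
    (s + - r) * (poly (suc n) (c ∘ suc) r + s * poly n q′ s) + (c 0 + r * poly (suc n) (c ∘ suc) r)
      ≡⟨ cong₂ (λ a b → (s + - r) * a + b) (horner n (quotient (suc n) c r) s) (horner (suc n) c r) ⟨
    (s + - r) * poly (suc n) (quotient (suc n) c r) s + poly (suc (suc n)) c r ∎
    where
    open ≡-Reasoning
    q′ = quotient n (c ∘ suc) r

  factor-theorem : ∀ n c {r s} → poly (suc n) c r ≡ 0# → poly (suc n) c s ≡ 0# → s ≡ r ⊎ poly n (quotient n c r) s ≡ 0#
  factor-theorem n c {r} {s} root-r root-s = Data.Sum.map (x∙y⁻¹≈ε⇒x≈y s r) id (x*y≡0⇒x≡0∨y≡0 (s + - r) (poly n q′ s) (begin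
    (s + - r) * poly n q′ s                    ≡⟨ +-identityʳ _ ⟨
    (s + - r) * poly n q′ s + 0#               ≡⟨ cong ((s + - r) * poly n q′ s +_) root-r ⟨
    (s + - r) * poly n q′ s + poly (suc n) c r ≡⟨ synthetic-division n c r s ⟨
    poly (suc n) c s                           ≡⟨ root-s ⟩
    0#                                         ∎))
    where
    open ≡-Reasoning
    q′ = quotient n c r

  #roots≤degree : ∀ n c → c n ≢ 0# → ∑ (λ s → 𝟙 (poly n c s ≟ 0#)) ℤ.≤ ℤ.+ n
  #roots≤degree zero c c₀≢0 = ℤP.≤-reflexive (trans (∑-cong (λ s → 𝟙-no (poly 0 c s ≟ 0#) (c₀≢0 ∘ trans (sym (*-identityʳ (c 0)))))) ∑-0)
  #roots≤degree (suc n) c cₙ≢0 with FinP.any? (λ r → poly (suc n) c r ≟ 0#)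
  ... | no no-root = ℤP.≤-trans (ℤP.≤-reflexive (trans (∑-cong (λ s → 𝟙-no (poly (suc n) c s ≟ 0#) (λ root → no-root (s , root)))) ∑-0)) (ℤ.+≤+ ℕ.z≤n)
  ... | yes (r , root) = begin
    ∑ (λ s → 𝟙 (poly (suc n) c s ≟ 0#))            ≤⟨ ∑-mono (λ s → 𝟙-⊎ (poly (suc n) c s ≟ 0#) (s ≟ r) (poly n q′ s ≟ 0#) (factor-theorem n c root)) ⟩
    ∑ (λ s → 𝟙 (s ≟ r) ℤ.+ 𝟙 (poly n q′ s ≟ 0#))  ≡⟨ trans (∑-+ _ _) (cong (ℤ._+ ∑ (λ s → 𝟙 (poly n q′ s ≟ 0#))) (∑-𝟙≡ r)) ⟩
    1ℤ ℤ.+ ∑ (λ s → 𝟙 (poly n q′ s ≟ 0#))          ≤⟨ ℤP.+-monoʳ-≤ 1ℤ (#roots≤degree n q′ (cₙ≢0 ∘ trans (sym (quotient-leading n c r)))) ⟩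
    1ℤ ℤ.+ ℤ.+ n                                   ∎
    where
    open ℤP.≤-Reasoning
    q′ = quotient n c r

  #fibre≤degree : ∀ (g : Poly) {d} → 1 ℕ.≤ d → HasDegree g d → ∀ u → ∑ (λ s → 𝟙 (evalP g s ≟ u)) ℤ.≤ ℤ.+ d
  #fibre≤degree g {suc d-1} _ (c-d≢0 , above-d) u =
    ℤP.≤-trans (ℤP.≤-reflexive (∑-cong (λ s → 𝟙-cong (evalP g s ≟ u) (poly d c-u s ≟ 0#) (to s) (from s))))
               (#roots≤degree d c-u c-d≢0)
    where
    d = suc d-1
    c = Poly.coeff g
    c-u : ℕ → F
    c-u zero    = c 0 + - u
    c-u (suc i) = c (suc i)
    d≤bound : d ℕ.≤ Poly.bound g
    d≤bound = ℕP.≮⇒≥ (λ bound<d → c-d≢0 (Poly.vanish g d bound<d))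
    evalP≡poly : ∀ s → evalP g s ≡ poly d c s
    evalP≡poly s = sumTo-truncate (Poly.bound g) d≤bound (λ i d<i _ → trans (cong (_* (s ^ i)) (above-d i d<i)) (zeroˡ _))
    shift : ∀ n s → poly n c-u s ≡ poly n c s + - u
    shift zero    s = solve 3 (λ c₀ u s → (c₀ :- u) :* con (ℤ.+ 1) := c₀ :* con (ℤ.+ 1) :- u) refl (c 0) u s
    shift (suc n) s = trans (cong (_+ c (suc n) * (s ^ suc n)) (shift n s))
                            (solve 3 (λ p u t → (p :- u) :+ t := (p :+ t) :- u) refl (poly n c s) u (c (suc n) * (s ^ suc n)))
    to : ∀ s → evalP g s ≡ u → poly d c-u s ≡ 0#
    to s gs≡u = trans (shift d s) (x≈y⇒x∙y⁻¹≈ε (trans (sym (evalP≡poly s)) gs≡u))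
    from : ∀ s → poly d c-u s ≡ 0# → evalP g s ≡ u
    from s root = trans (evalP≡poly s) (x∙y⁻¹≈ε⇒x≈y _ u (trans (sym (shift d s)) root))

module Admissibility {q : ℕ} (𝔽 : FiniteField q) where

  open import Data.Nat as ℕ using (ℕ; zero; suc; _∸_)
  import Data.Nat.Properties as ℕP
  open import Data.Fin as Fin using (Fin; toℕ)
  import Data.Fin.Properties as FinP
  open import Data.Product using (∃; _×_; _,_; proj₁; proj₂)
  open import Data.Sum as Sum using (_⊎_; inj₁; inj₂)
  open import Data.Empty using (⊥; ⊥-elim)
  open import Relation.Binary.PropositionalEquality
  open import Function using (_∘_)
  open import Relation.Binary.Definitions using (tri<; tri≈; tri>)
  open import Relation.Nullary using (¬_; yes; no)
  open import Relation.Nullary.Decidable using (¬?; decidable-stable)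
  open import Relation.Unary using (Pred; Decidable)
  open import Level using (0ℓ)
  open FieldFacts 𝔽
  open Polynomials 𝔽 using (sumTo-cong; sumTo-zero; sumTo-single)
  open FF 𝔽 using (sumTo; Poly2; mulCoeff; IsProduct; InX; InY; Primitive; PrimitiveKernel;
                   ConstTimesSquare; Admissible; DegX1; DegY1)
  open Poly2

  sumTo-+ : ∀ n (φ ψ : ℕ → F) → sumTo n (λ i → φ i + ψ i) ≡ sumTo n φ + sumTo n ψ
  sumTo-+ zero    φ ψ = refl
  sumTo-+ (suc n) φ ψ = trans (cong (_+ (φ (suc n) + ψ (suc n))) (sumTo-+ n φ ψ))
    (solve 4 (λ a b c d → (a :+ b) :+ (c :+ d) := (a :+ c) :+ (b :+ d)) refl (sumTo n φ) (sumTo n ψ) (φ (suc n)) (ψ (suc n)))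

  sumTo-swap : ∀ m n (φ : ℕ → ℕ → F) → sumTo m (λ k → sumTo n (φ k)) ≡ sumTo n (λ l → sumTo m (λ k → φ k l))
  sumTo-swap zero    n φ = refl
  sumTo-swap (suc m) n φ = trans (cong (_+ sumTo n (φ (suc m))) (sumTo-swap m n φ))
                                 (sym (sumTo-+ n (λ l → sumTo m (λ k → φ k l)) (φ (suc m))))

  transpose : Poly2 → Poly2
  transpose P = record
    { coeff  = λ i j → coeff P j i
    ; bound  = bound P
    ; vanish = λ i j out → vanish P j i (Sum.swap out)
    }

  mulCoeff-transpose : ∀ P Q i j → mulCoeff (transpose P) (transpose Q) i j ≡ mulCoeff P Q j i
  mulCoeff-transpose P Q i j = sumTo-swap i j (λ k l → coeff P l k * coeff Q (j ∸ l) (i ∸ k))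

  oneCoeff : ℕ → ℕ → F
  oneCoeff zero    zero    = 1#
  oneCoeff zero    (suc _) = 0#
  oneCoeff (suc _) _       = 0#

  oneCoeff-sym : ∀ i j → oneCoeff i j ≡ oneCoeff j i
  oneCoeff-sym zero    zero    = refl
  oneCoeff-sym zero    (suc _) = refl
  oneCoeff-sym (suc _) zero    = refl
  oneCoeff-sym (suc _) (suc _) = refl

  oneCoeffˡ : ∀ i j → 0 ℕ.< i → oneCoeff i j ≡ 0#
  oneCoeffˡ (suc _) _ _ = refl

  oneCoeffʳ : ∀ i j → 0 ℕ.< j → oneCoeff i j ≡ 0#
  oneCoeffʳ zero    (suc _) _ = refl
  oneCoeffʳ (suc _) _       _ = refl

  one : Poly2
  one = record { coeff = oneCoeff ; bound = 0 ; vanish = λ i j → Sum.[ oneCoeffˡ i j , oneCoeffʳ i j ] }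

  *-oneʳ : ∀ P i j → mulCoeff P one i j ≡ coeff P i j
  *-oneʳ P i j = begin
    mulCoeff P one i j                                      ≡⟨ sumTo-single i ℕP.≤-refl (λ k k≤i k≢i → sumTo-zero j (λ l _ → earlier-row k l k≤i k≢i)) ⟩
    sumTo j (λ l → coeff P i l * oneCoeff (i ∸ i) (j ∸ l))  ≡⟨ sumTo-single j ℕP.≤-refl earlier-column ⟩
    coeff P i j * oneCoeff (i ∸ i) (j ∸ j)                  ≡⟨ cong₂ (λ x y → coeff P i j * oneCoeff x y) (ℕP.n∸n≡0 i) (ℕP.n∸n≡0 j) ⟩
    coeff P i j * 1#                                        ≡⟨ *-identityʳ (coeff P i j) ⟩
    coeff P i j                                             ∎
    where
    open ≡-Reasoning
    earlier-row : ∀ k l → k ℕ.≤ i → k ≢ i → coeff P k l * oneCoeff (i ∸ k) (j ∸ l) ≡ 0#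
    earlier-row k l k≤i k≢i = trans (cong (coeff P k l *_) (oneCoeffˡ (i ∸ k) (j ∸ l) (ℕP.m<n⇒0<n∸m (ℕP.≤∧≢⇒< k≤i k≢i)))) (zeroʳ _)
    earlier-column : ∀ l → l ℕ.≤ j → l ≢ j → coeff P i l * oneCoeff (i ∸ i) (j ∸ l) ≡ 0#
    earlier-column l l≤j l≢j = trans (cong (coeff P i l *_) (oneCoeffʳ (i ∸ i) (j ∸ l) (ℕP.m<n⇒0<n∸m (ℕP.≤∧≢⇒< l≤j l≢j)))) (zeroʳ _)

  greatest : ∀ {P : Pred ℕ 0ℓ} → Decidable P → ∀ B → (∀ k → B ℕ.< k → ¬ P k) →
             ∀ {i} → P i → ∃ λ m → i ℕ.≤ m × P m × (∀ k → m ℕ.< k → ¬ P k)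
  greatest P? B above-B {i} Pi with P? B
  ... | yes PB = B , ℕP.≮⇒≥ (λ B<i → above-B i B<i Pi) , PB , above-B
  greatest P? zero above-B {i} Pi | no ¬P0 with ℕP.n≤0⇒n≡0 (ℕP.≮⇒≥ (λ 0<i → above-B i 0<i Pi))
  ... | refl = ⊥-elim (¬P0 Pi)
  greatest P? (suc B) above-1+B Pi | no ¬P1+B = greatest P? B above-B Pi
    where
    above-B : ∀ k → B ℕ.< k → ¬ _
    above-B k B<k with ℕP.m≤n⇒m<n∨m≡n B<k
    ... | inj₁ 1+B<k = above-1+B k 1+B<k
    ... | inj₂ refl  = ¬P1+B

  -- The product of the top-degree coefficients in x survives in P * Q.
  module _ {P Q : Poly2} (P∈F[x] : InX P) (PQ≡1 : IsProduct one P Q) where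

    private
      Q₀₀≢0 : coeff Q 0 0 ≢ 0#
      Q₀₀≢0 Q₀₀≡0 = FiniteField.0≢1 𝔽 (sym (trans (PQ≡1 0 0) (trans (cong (coeff P 0 0 *_) Q₀₀≡0) (zeroʳ _))))

      NonzeroRow : ℕ → Set
      NonzeroRow k = ∃ λ (l : Fin (suc (bound Q))) → coeff Q k (toℕ l) ≢ 0#

      top-row-of-Q : ∃ λ n → NonzeroRow n × (∀ k l → n ℕ.< k → coeff Q k l ≡ 0#)
      top-row-of-Q with greatest (λ k → FinP.any? (λ l → ¬? (coeff Q k (toℕ l) ≟ 0#))) (bound Q)
                              (λ k B<k (l , Qₖₗ≢0) → Qₖₗ≢0 (vanish Q k (toℕ l) (inj₁ B<k))) (Fin.zero , Q₀₀≢0)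
      ... | n , _ , row-n , above-n = n , row-n , vanishes
        where
        vanishes : ∀ k l → n ℕ.< k → coeff Q k l ≡ 0#
        vanishes k l n<k with l ℕ.<? suc (bound Q)
        ... | yes l<1+B = decidable-stable (coeff Q k l ≟ 0#) (λ Qₖₗ≢0 →
                            above-n k n<k (Fin.fromℕ< l<1+B , subst (λ j → coeff Q k j ≢ 0#) (sym (FinP.toℕ-fromℕ< l<1+B)) Qₖₗ≢0))
        ... | no l≮1+B = vanish Q k l (inj₂ (ℕP.≰⇒> (l≮1+B ∘ ℕ.s≤s)))

    x-unit-constant : ∀ {i} → 0 ℕ.< i → coeff P i 0 ≡ 0#
    x-unit-constant {i} 0<i = decidable-stable (coeff P i 0 ≟ 0#) λ Pᵢ₀≢0 → top-terms-survive Pᵢ₀≢0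
      where
      top-terms-survive : coeff P i 0 ≢ 0# → ⊥
      top-terms-survive Pᵢ₀≢0 with greatest (λ k → ¬? (coeff P k 0 ≟ 0#)) (bound P) (λ k B<k Pₖ₀≢0 → Pₖ₀≢0 (vanish P k 0 (inj₁ B<k))) Pᵢ₀≢0
                              | top-row-of-Q
      ... | m , i≤m , Pₘ₀≢0 , above-m | n , (l′ , Qₙₗ≢0) , above-n = *-≢0 Pₘ₀≢0 Qₙₗ≢0 (begin
        coeff P m 0 * coeff Q n l                           ≡⟨ leading ⟨
        mulCoeff P Q (m ℕ.+ n) l                            ≡⟨ PQ≡1 (m ℕ.+ n) l ⟨
        oneCoeff (m ℕ.+ n) l                                ≡⟨ oneCoeffˡ (m ℕ.+ n) l (ℕP.≤-trans (ℕP.≤-trans 0<i i≤m) (ℕP.m≤m+n m n)) ⟩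
        0#                                                  ∎)
        where
        open ≡-Reasoning
        l = toℕ l′
        P-above-m : ∀ k → m ℕ.< k → coeff P k 0 ≡ 0#
        P-above-m k m<k = decidable-stable (coeff P k 0 ≟ 0#) (above-m k m<k)
        only-x⁰ : ∀ k j → j ℕ.≤ l → j ≢ 0 → coeff P k j * coeff Q (m ℕ.+ n ∸ k) (l ∸ j) ≡ 0#
        only-x⁰ k j _ j≢0 = trans (cong (_* coeff Q (m ℕ.+ n ∸ k) (l ∸ j)) (P∈F[x] k j (ℕP.n≢0⇒n>0 j≢0))) (zeroˡ _)
        only-m : ∀ k → k ℕ.≤ m ℕ.+ n → k ≢ m → coeff P k 0 * coeff Q (m ℕ.+ n ∸ k) l ≡ 0#
        only-m k _ k≢m with ℕP.<-cmp k m
        ... | tri< k<m _ _ = trans (cong (coeff P k 0 *_) (above-n (m ℕ.+ n ∸ k) l n<m+n-k)) (zeroʳ _)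
          where
          n<m+n-k : n ℕ.< m ℕ.+ n ∸ k
          n<m+n-k = subst (n ℕ.<_) (sym (ℕP.+-∸-comm n (ℕP.<⇒≤ k<m))) (ℕP.+-monoˡ-≤ n (ℕP.m<n⇒0<n∸m k<m))
        ... | tri≈ _ k≡m _ = ⊥-elim (k≢m k≡m)
        ... | tri> _ _ m<k = trans (cong (_* coeff Q (m ℕ.+ n ∸ k) l) (P-above-m k m<k)) (zeroˡ _)
        leading : mulCoeff P Q (m ℕ.+ n) l ≡ coeff P m 0 * coeff Q n l
        leading = begin
          mulCoeff P Q (m ℕ.+ n) l                             ≡⟨ sumTo-cong (m ℕ.+ n) (λ k → sumTo-single l ℕ.z≤n (only-x⁰ k)) ⟩
          sumTo (m ℕ.+ n) (λ k → coeff P k 0 * coeff Q (m ℕ.+ n ∸ k) l) ≡⟨ sumTo-single (m ℕ.+ n) (ℕP.m≤m+n m n) only-m ⟩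
          coeff P m 0 * coeff Q (m ℕ.+ n ∸ m) l                ≡⟨ cong (λ t → coeff P m 0 * coeff Q t l) (ℕP.m+n∸m≡n m n) ⟩
          coeff P m 0 * coeff Q n l                            ∎

    x-unit-constant-term-only : ∀ i j → 0 ℕ.< i ⊎ 0 ℕ.< j → coeff P i j ≡ 0#
    x-unit-constant-term-only i zero    (inj₁ 0<i) = x-unit-constant 0<i
    x-unit-constant-term-only i (suc j) _          = P∈F[x] i (suc j) (ℕ.s≤s ℕ.z≤n)

  -- A unit in F[y] is a unit in F[x] after swapping the variables.
  one-primitive : Primitive one
  one-primitive P (inj₁ P∈F[x]) (i , j , nonconstant , Pᵢⱼ≢0) (Q , PQ≡1) =
    Pᵢⱼ≢0 (x-unit-constant-term-only {P} {Q} P∈F[x] PQ≡1 i j nonconstant)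
  one-primitive P (inj₂ P∈F[y]) (i , j , nonconstant , Pᵢⱼ≢0) (Q , PQ≡1) =
    Pᵢⱼ≢0 (x-unit-constant-term-only {transpose P} {transpose Q} (λ k l → P∈F[y] l k) PᵀQᵀ≡1 j i (Sum.swap nonconstant))
    where
    PᵀQᵀ≡1 : IsProduct one (transpose P) (transpose Q)
    PᵀQᵀ≡1 k l = trans (oneCoeff-sym k l) (trans (PQ≡1 l k) (sym (mulCoeff-transpose P Q k l)))

  mulCoeff-x-y : ∀ {X Y} → InX X → InY Y → ∀ i j → mulCoeff X Y i j ≡ coeff X i 0 * coeff Y 0 j
  mulCoeff-x-y {X} {Y} X∈F[x] Y∈F[y] i j = begin
    mulCoeff X Y i j                                  ≡⟨ sumTo-single i ℕP.≤-refl (λ k k≤i k≢i → sumTo-zero j (λ l _ → earlier-row k l k≤i k≢i)) ⟩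
    sumTo j (λ l → coeff X i l * coeff Y (i ∸ i) (j ∸ l)) ≡⟨ sumTo-single j ℕ.z≤n (λ l _ l≢0 → trans (cong (_* coeff Y (i ∸ i) (j ∸ l)) (X∈F[x] i l (ℕP.n≢0⇒n>0 l≢0))) (zeroˡ _)) ⟩
    coeff X i 0 * coeff Y (i ∸ i) j                   ≡⟨ cong (λ t → coeff X i 0 * coeff Y t j) (ℕP.n∸n≡0 i) ⟩
    coeff X i 0 * coeff Y 0 j                         ∎
    where
    open ≡-Reasoning
    earlier-row : ∀ k l → k ℕ.≤ i → k ≢ i → coeff X k l * coeff Y (i ∸ k) (j ∸ l) ≡ 0#
    earlier-row k l k≤i k≢i = trans (cong (coeff X k l *_) (Y∈F[y] (i ∸ k) (j ∸ l) (ℕP.m<n⇒0<n∸m (ℕP.≤∧≢⇒< k≤i k≢i)))) (zeroʳ _)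

  module Bidegree11 (f : Poly2) (degX : DegX1 f) (degY : DegY1 f) where

    a b c e : F
    a = coeff f 1 1
    b = coeff f 1 0
    c = coeff f 0 1
    e = coeff f 0 0

    -- When a ≢ 0 and a e = b c, f = (a x + c) (y + b/a).
    module _ (a≢0 : a ≢ 0#) (ae≡bc : a * e + - (b * c) ≡ 0#) where

      private
        β = b * a ⁻¹

        xCoeff : ℕ → ℕ → F
        xCoeff 0 0 = c
        xCoeff 1 0 = a
        xCoeff _ _ = 0#

        yCoeff : ℕ → ℕ → F
        yCoeff 0 0 = β
        yCoeff 0 1 = 1#
        yCoeff _ _ = 0#

      xFactor : Poly2
      xFactor = record { coeff = xCoeff ; bound = 1 ; vanish = vanish₁ }
        where
        vanish₁ : ∀ i j → 1 ℕ.< i ⊎ 1 ℕ.< j → xCoeff i j ≡ 0#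
        vanish₁ (suc (suc _)) _             _ = refl
        vanish₁ 0             (suc (suc _)) _ = refl
        vanish₁ 1             (suc (suc _)) _ = refl
        vanish₁ 0             1             _ = refl
        vanish₁ 1             1             _ = refl
        vanish₁ 0             0             (inj₁ ())
        vanish₁ 0             0             (inj₂ ())
        vanish₁ 1             0             (inj₁ (ℕ.s≤s ()))
        vanish₁ 1             0             (inj₂ ())

      yFactor : Poly2
      yFactor = record { coeff = yCoeff ; bound = 1 ; vanish = vanish₁ }
        where
        vanish₁ : ∀ i j → 1 ℕ.< i ⊎ 1 ℕ.< j → yCoeff i j ≡ 0#
        vanish₁ (suc _) _             _ = refl
        vanish₁ 0       (suc (suc _)) _ = refl
        vanish₁ 0       0             (inj₁ ())
        vanish₁ 0       0             (inj₂ ())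
        vanish₁ 0       1             (inj₁ ())
        vanish₁ 0       1             (inj₂ (ℕ.s≤s ()))

      xFactor∈F[x] : InX xFactor
      xFactor∈F[x] 0             (suc _) _ = refl
      xFactor∈F[x] 1             (suc _) _ = refl
      xFactor∈F[x] (suc (suc _)) (suc _) _ = refl

      yFactor∈F[y] : InY yFactor
      yFactor∈F[y] (suc _) _ _ = refl

      f≡xFactor*yFactor : IsProduct f xFactor yFactor
      f≡xFactor*yFactor i j = trans (coefficient i j) (sym (mulCoeff-x-y {xFactor} {yFactor} xFactor∈F[x] yFactor∈F[y] i j))
        where
        aβ≡b : a * β ≡ b
        aβ≡b = trans (solve 3 (λ a b i → a :* (b :* i) := b :* (a :* i)) refl a b (a ⁻¹)) (trans (cong (b *_) (x*x⁻¹≡1 a≢0)) (*-identityʳ b))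
        e≡cβ : e ≡ c * β
        e≡cβ = *-cancelˡ e (c * β) a≢0 (begin
          a * e                        ≡⟨ solve 2 (λ x y → x := (x :- y) :+ y) refl (a * e) (b * c) ⟩
          (a * e + - (b * c)) + b * c  ≡⟨ cong (_+ b * c) ae≡bc ⟩
          0# + b * c                   ≡⟨ +-identityˡ (b * c) ⟩
          b * c                        ≡⟨ cong (_* c) aβ≡b ⟨
          (a * β) * c                  ≡⟨ solve 3 (λ a β c → (a :* β) :* c := a :* (c :* β)) refl a β c ⟩
          a * (c * β)                  ∎)
          where open ≡-Reasoning
        coefficient : ∀ i j → coeff f i j ≡ xCoeff i 0 * yCoeff 0 j
        coefficient 0             0             = e≡cβ
        coefficient 0             1             = sym (*-identityʳ c)
        coefficient 1             0             = sym aβ≡b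
        coefficient 1             1             = sym (*-identityʳ a)
        coefficient 0             (suc (suc j)) = trans (proj₁ degY 0 (suc (suc j)) (ℕ.s≤s (ℕ.s≤s ℕ.z≤n))) (sym (zeroʳ c))
        coefficient 1             (suc (suc j)) = trans (proj₁ degY 1 (suc (suc j)) (ℕ.s≤s (ℕ.s≤s ℕ.z≤n))) (sym (zeroʳ a))
        coefficient (suc (suc i)) j             = trans (proj₁ degX (suc (suc i)) j (ℕ.s≤s (ℕ.s≤s ℕ.z≤n))) (sym (zeroˡ (yCoeff 0 j)))

      kernel-one : PrimitiveKernel f one
      kernel-one = xFactor , yFactor , xFactor∈F[x] , yFactor∈F[y] , (f , f≡xFactor*yFactor , λ i j → sym (*-oneʳ f i j)) , one-primitive

    one-square : ConstTimesSquare one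
    one-square = 1# , one , λ i j → sym (trans (*-identityˡ _) (*-oneʳ one i j))

    admissible⇒ae≢bc : Admissible f → a * e + - (b * c) ≢ 0#
    admissible⇒ae≢bc admissible ae≡bc with a ≟ 0#
    ... | no a≢0  = proj₂ admissible one (kernel-one a≢0 ae≡bc) one-square
    ... | yes a≡0 = *-≢0 b≢0 c≢0 (begin
      b * c                          ≡⟨ solve 2 (λ x y → y := x :- (x :- y)) refl (a * e) (b * c) ⟩
      a * e + - (a * e + - (b * c))  ≡⟨ cong₂ (λ s t → s + - t) (trans (cong (_* e) a≡0) (zeroˡ e)) ae≡bc ⟩
      0# + - 0#                      ≡⟨ -‿inverseʳ 0# ⟩
      0#                             ∎)
      where
      open ≡-Reasoning
      b≢0 : b ≢ 0#
      b≢0 with proj₂ degX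
      ... | 0           , f₁₀≢0 = f₁₀≢0
      ... | 1           , f₁₁≢0 = ⊥-elim (f₁₁≢0 a≡0)
      ... | suc (suc j) , f₁ⱼ≢0 = ⊥-elim (f₁ⱼ≢0 (proj₁ degY 1 (suc (suc j)) (ℕ.s≤s (ℕ.s≤s ℕ.z≤n))))
      c≢0 : c ≢ 0#
      c≢0 with proj₂ degY
      ... | 0           , f₀₁≢0 = f₀₁≢0
      ... | 1           , f₁₁≢0 = ⊥-elim (f₁₁≢0 a≡0)
      ... | suc (suc i) , fᵢ₁≢0 = ⊥-elim (fᵢ₁≢0 (proj₁ degX (suc (suc i)) 1 (ℕ.s≤s (ℕ.s≤s ℕ.z≤n))))

module Discrepancy {q : ℕ} (𝔽 : FiniteField q) (q-odd : q ℕ.% 2 ≡ 1)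
  (form : CharacterSums.Nondegenerate 𝔽 q-odd)
  (g : FF.Poly 𝔽) {d : ℕ} (1≤d : 1 ℕ.≤ d) (deg-g : FF.HasDegree 𝔽 g d) where

  open import Data.Fin as Fin using (Fin)
  open import Data.Fin.Subset using (Subset; ∣_∣)
  open import Data.Fin.Subset.Properties using (_∈?_)
  open import Data.Integer as ℤ using (ℤ; +_; _+_; _*_; -_; _-_; _≤_; 0ℤ; 1ℤ; +≤+)
  import Data.Integer.Properties as ℤP
  open import Data.Integer.Tactic.RingSolver using (solve-∀)
  open import Data.Bool.Properties using (T?)
  open import Data.Product using (proj₂)
  open import Data.Sum using (_⊎_)
  open import Relation.Binary.PropositionalEquality
  open import Relation.Nullary using (Dec; yes; no; does)
  open import Relation.Nullary.Decidable using (_×-dec_)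
  open import Function using (_∘_)
  open IntegerSums
  open Counting using (∣S∣≡∑𝟙∈; #pairs; 𝟙-×-dec)
  open CharacterSums 𝔽 q-odd using (F; 0#; _≟_; χ; module BilinearCharacter; isSquare?; 2·𝟙square-1≡χ+𝟙zero)
  open BilinearCharacter form using (bilinear; χ-bilinear; bilinear-bound; unique-root-u; unique-root-v)
  open Polynomials 𝔽 using (#fibre≤degree)

  g⟨_⟩ : F → F
  g⟨ s ⟩ = FF.evalP 𝔽 g s

  𝟙[_∈_] : F → Subset q → ℤ
  𝟙[ s ∈ S ] = 𝟙 (s ∈? S)

  fibre : Subset q → F → ℤ
  fibre S u = ∑ (λ s → 𝟙[ s ∈ S ] * 𝟙 (u ≟ g⟨ s ⟩))

  ∑-along-g : ∀ S (Φ : F → ℤ) → ∑ (λ s → 𝟙[ s ∈ S ] * Φ g⟨ s ⟩) ≡ ∑ (λ u → fibre S u * Φ u)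
  ∑-along-g S Φ = begin
    ∑ (λ s → 𝟙[ s ∈ S ] * Φ g⟨ s ⟩)                          ≡⟨ ∑-cong (λ s → cong (𝟙[ s ∈ S ] *_) (∑-δ g⟨ s ⟩ Φ)) ⟨
    ∑ (λ s → 𝟙[ s ∈ S ] * ∑ (λ u → 𝟙 (u ≟ g⟨ s ⟩) * Φ u))     ≡⟨ ∑-cong (λ s → trans (∑-cong (λ u → ℤP.*-assoc 𝟙[ s ∈ S ] (𝟙 (u ≟ g⟨ s ⟩)) (Φ u))) (∑-*ˡ 𝟙[ s ∈ S ] (λ u → 𝟙 (u ≟ g⟨ s ⟩) * Φ u))) ⟨
    ∑ (λ s → ∑ (λ u → (𝟙[ s ∈ S ] * 𝟙 (u ≟ g⟨ s ⟩)) * Φ u))   ≡⟨ ∑-comm _ ⟩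
    ∑ (λ u → ∑ (λ s → (𝟙[ s ∈ S ] * 𝟙 (u ≟ g⟨ s ⟩)) * Φ u))   ≡⟨ ∑-cong (λ u → ∑-*ʳ (Φ u) _) ⟩
    ∑ (λ u → fibre S u * Φ u)                                 ∎
    where open ≡-Reasoning

  ∑-fibre : ∀ S → ∑ (fibre S) ≡ + ∣ S ∣
  ∑-fibre S = begin
    ∑ (fibre S)                      ≡⟨ ∑-cong (λ u → ℤP.*-identityʳ (fibre S u)) ⟨
    ∑ (λ u → fibre S u * 1ℤ)         ≡⟨ ∑-along-g S (λ _ → 1ℤ) ⟨
    ∑ (λ s → 𝟙[ s ∈ S ] * 1ℤ)        ≡⟨ ∑-cong (λ s → ℤP.*-identityʳ 𝟙[ s ∈ S ]) ⟩
    ∑ (λ s → 𝟙[ s ∈ S ])             ≡⟨ ∣S∣≡∑𝟙∈ S ⟨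
    + ∣ S ∣                          ∎
    where open ≡-Reasoning

  fibre-nonneg : ∀ S u → 0ℤ ≤ fibre S u
  fibre-nonneg S u = ∑-nonneg (λ s → *-nonneg (𝟙-nonneg (s ∈? S)) (𝟙-nonneg (u ≟ g⟨ s ⟩)))

  fibre≤d : ∀ S u → fibre S u ≤ + d
  fibre≤d S u = ℤP.≤-trans (∑-mono (λ s → ℤP.≤-trans (*-monoʳ-≤-0≤ _ (𝟙-nonneg (u ≟ g⟨ s ⟩)) (𝟙-≤1 (s ∈? S))) (ℤP.≤-reflexive (ℤP.*-identityˡ _))))
                           (ℤP.≤-trans (ℤP.≤-reflexive (∑-cong (λ s → 𝟙-cong (u ≟ g⟨ s ⟩) (g⟨ s ⟩ ≟ u) sym sym)))
                                       (#fibre≤degree g 1≤d deg-g u))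

  ∑[κ·fibre]²≤ : ∀ (κ : F → ℤ) → (∀ u → ℤ.∣ κ u ∣ ℕ.≤ 1) → ∀ S → ∑ (λ u → sq (κ u * fibre S u)) ≤ + d * + ∣ S ∣
  ∑[κ·fibre]²≤ κ ∣κ∣≤1 S = begin
    ∑ (λ u → sq (κ u * fibre S u))          ≡⟨ ∑-cong (λ u → square-product (κ u) (fibre S u)) ⟩
    ∑ (λ u → sq (κ u) * sq (fibre S u))     ≤⟨ ∑-mono (λ u → *-monoʳ-≤-0≤ _ (sq-nonneg (fibre S u)) (∣i∣≤1⇒sq≤1 (κ u) (∣κ∣≤1 u))) ⟩
    ∑ (λ u → 1ℤ * sq (fibre S u))           ≤⟨ ∑-mono (λ u → ℤP.≤-trans (ℤP.≤-reflexive (ℤP.*-identityˡ _)) (*-monoʳ-≤-0≤ _ (fibre-nonneg S u) (fibre≤d S u))) ⟩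
    ∑ (λ u → + d * fibre S u)               ≡⟨ trans (∑-*ˡ (+ d) (fibre S)) (cong (+ d *_) (∑-fibre S)) ⟩
    + d * + ∣ S ∣                           ∎
    where
    open ℤP.≤-Reasoning
    square-product : ∀ x y → (x * y) * (x * y) ≡ (x * x) * (y * y)
    square-product = solve-∀

  module Pairs (S T : Subset q) where

    weight : F → F → ℤ
    weight s t = 𝟙[ s ∈ S ] * 𝟙[ t ∈ T ]

    weight-nonneg : ∀ s t → 0ℤ ≤ weight s t
    weight-nonneg s t = *-nonneg (𝟙-nonneg (s ∈? S)) (𝟙-nonneg (t ∈? T))

    ∑∑ : (F → F → ℤ) → ℤ
    ∑∑ y = ∑ (λ s → ∑ (λ t → weight s t * y s t))

    ∑∑-cong : ∀ {y y′} → (∀ s t → y s t ≡ y′ s t) → ∑∑ y ≡ ∑∑ y′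
    ∑∑-cong y≗y′ = ∑-cong (λ s → ∑-cong (λ t → cong (weight s t *_) (y≗y′ s t)))

    ∑∑-+ : ∀ y y′ → ∑∑ (λ s t → y s t + y′ s t) ≡ ∑∑ y + ∑∑ y′
    ∑∑-+ y y′ = trans (∑-cong (λ s → trans (∑-cong (λ t → ℤP.*-distribˡ-+ (weight s t) (y s t) (y′ s t)))
                                            (∑-+ (λ t → weight s t * y s t) (λ t → weight s t * y′ s t))))
                      (∑-+ (λ s → ∑ (λ t → weight s t * y s t)) (λ s → ∑ (λ t → weight s t * y′ s t)))

    ∑∑-neg : ∀ y → ∑∑ (λ s t → - y s t) ≡ - ∑∑ y
    ∑∑-neg y = trans (∑-cong (λ s → trans (∑-cong (λ t → sym (ℤP.neg-distribʳ-* (weight s t) (y s t)))) (∑-neg (λ t → weight s t * y s t))))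
                     (∑-neg (λ s → ∑ (λ t → weight s t * y s t)))

    ∑∑-sub : ∀ y y′ → ∑∑ (λ s t → y s t - y′ s t) ≡ ∑∑ y - ∑∑ y′
    ∑∑-sub y y′ = trans (∑∑-+ y (λ s t → - y′ s t)) (cong (_+_ (∑∑ y)) (∑∑-neg y′))

    ∑∑-*ˡ : ∀ k y → ∑∑ (λ s t → k * y s t) ≡ k * ∑∑ y
    ∑∑-*ˡ k y = trans (∑-cong (λ s → trans (∑-cong (λ t → swap (weight s t) k (y s t))) (∑-*ˡ k (λ t → weight s t * y s t))))
                      (∑-*ˡ k (λ s → ∑ (λ t → weight s t * y s t)))
      where
      swap : ∀ w k y → w * (k * y) ≡ k * (w * y)
      swap = solve-∀

    ∑∑-mono : ∀ {y y′} → (∀ s t → y s t ≤ y′ s t) → ∑∑ y ≤ ∑∑ y′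
    ∑∑-mono y≤y′ = ∑-mono (λ s → ∑-mono (λ t → *-monoˡ-≤-0≤ (weight s t) (weight-nonneg s t) (y≤y′ s t)))

    ∑∑-nonneg : ∀ {y} → (∀ s t → 0ℤ ≤ y s t) → 0ℤ ≤ ∑∑ y
    ∑∑-nonneg 0≤y = ∑-nonneg (λ s → ∑-nonneg (λ t → *-nonneg (weight-nonneg s t) (0≤y s t)))

    ∑∑-1 : ∑∑ (λ _ _ → 1ℤ) ≡ + ∣ S ∣ * + ∣ T ∣
    ∑∑-1 = begin
      ∑∑ (λ _ _ → 1ℤ)                                   ≡⟨ ∑-cong (λ s → ∑-cong (λ t → ℤP.*-identityʳ (weight s t))) ⟩
      ∑ (λ s → ∑ (λ t → 𝟙[ s ∈ S ] * 𝟙[ t ∈ T ]))       ≡⟨ ∑-product (λ s → 𝟙[ s ∈ S ]) (λ t → 𝟙[ t ∈ T ]) ⟩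
      ∑ (λ s → 𝟙[ s ∈ S ]) * ∑ (λ t → 𝟙[ t ∈ T ])       ≡⟨ cong₂ _*_ (∣S∣≡∑𝟙∈ S) (∣S∣≡∑𝟙∈ T) ⟨
      + ∣ S ∣ * + ∣ T ∣                                 ∎
      where open ≡-Reasoning

    ∑∑-rows : ∀ {y K} → (∀ s t → 0ℤ ≤ y s t) → (∀ s → ∑ (y s) ≤ K) → ∑∑ y ≤ + ∣ S ∣ * K
    ∑∑-rows {y} {K} 0≤y row≤K = begin
      ∑∑ y                                               ≤⟨ ∑-mono (λ s → ∑-mono (λ t → drop-t s t)) ⟩
      ∑ (λ s → ∑ (λ t → 𝟙[ s ∈ S ] * y s t))             ≡⟨ ∑-cong (λ s → ∑-*ˡ 𝟙[ s ∈ S ] (y s)) ⟩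
      ∑ (λ s → 𝟙[ s ∈ S ] * ∑ (y s))                     ≤⟨ ∑-mono (λ s → *-monoˡ-≤-0≤ 𝟙[ s ∈ S ] (𝟙-nonneg (s ∈? S)) (row≤K s)) ⟩
      ∑ (λ s → 𝟙[ s ∈ S ] * K)                           ≡⟨ trans (∑-*ʳ K (λ s → 𝟙[ s ∈ S ])) (cong (_* K) (sym (∣S∣≡∑𝟙∈ S))) ⟩
      + ∣ S ∣ * K                                        ∎
      where
      open ℤP.≤-Reasoning
      drop-t : ∀ s t → weight s t * y s t ≤ 𝟙[ s ∈ S ] * y s t
      drop-t s t = begin
        (𝟙[ s ∈ S ] * 𝟙[ t ∈ T ]) * y s t   ≡⟨ ℤP.*-assoc 𝟙[ s ∈ S ] 𝟙[ t ∈ T ] (y s t) ⟩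
        𝟙[ s ∈ S ] * (𝟙[ t ∈ T ] * y s t)   ≤⟨ *-monoˡ-≤-0≤ 𝟙[ s ∈ S ] (𝟙-nonneg (s ∈? S)) (*-monoʳ-≤-0≤ (y s t) (0≤y s t) (𝟙-≤1 (t ∈? T))) ⟩
        𝟙[ s ∈ S ] * (1ℤ * y s t)           ≡⟨ cong (𝟙[ s ∈ S ] *_) (ℤP.*-identityˡ (y s t)) ⟩
        𝟙[ s ∈ S ] * y s t                  ∎

  open Pairs using (∑∑)

  ∑∑-flip : ∀ (S T : Subset q) y → ∑∑ S T y ≡ ∑∑ T S (λ t s → y s t)
  ∑∑-flip S T y = trans (∑-comm _) (∑-cong (λ t → ∑-cong (λ s → cong (_* y s t) (ℤP.*-comm 𝟙[ s ∈ S ] 𝟙[ t ∈ T ]))))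

  ∑∑²≤ : ∀ (S T : Subset q) {y K L} → (∀ s t → 0ℤ ≤ y s t) → (∀ s → ∑ (y s) ≤ K) → (∀ t → ∑ (λ s → y s t) ≤ L) →
         sq (∑∑ S T y) ≤ (+ ∣ S ∣ * K) * (+ ∣ T ∣ * L)
  ∑∑²≤ S T {y} 0≤y rows≤K columns≤L = sq≤* (Pairs.∑∑-nonneg S T 0≤y) (Pairs.∑∑-rows S T 0≤y rows≤K)
    (ℤP.≤-trans (ℤP.≤-reflexive (∑∑-flip S T y)) (Pairs.∑∑-rows T S (λ t s → 0≤y s t) columns≤L))

  module _ (κ : F → ℤ) (∣κ∣≤1 : ∀ u → ℤ.∣ κ u ∣ ℕ.≤ 1) (S T : Subset q) where

    private
      α β : F → ℤ
      α u = κ u * fibre S u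
      β v = κ v * fibre T v

    ∑∑-along-g : ∑∑ S T (λ s t → (κ g⟨ s ⟩ * κ g⟨ t ⟩) * χ-bilinear g⟨ s ⟩ g⟨ t ⟩)
                 ≡ ∑ (λ u → ∑ (λ v → (α u * β v) * χ-bilinear u v))
    ∑∑-along-g = begin
      ∑ (λ s → ∑ (λ t → (𝟙[ s ∈ S ] * 𝟙[ t ∈ T ]) * ((κ g⟨ s ⟩ * κ g⟨ t ⟩) * χ-bilinear g⟨ s ⟩ g⟨ t ⟩)))
        ≡⟨ ∑-cong (λ s → trans (∑-cong (λ t → regroup₁ 𝟙[ s ∈ S ] 𝟙[ t ∈ T ] (κ g⟨ s ⟩) (κ g⟨ t ⟩) (χ-bilinear g⟨ s ⟩ g⟨ t ⟩)))
                               (trans (∑-*ˡ 𝟙[ s ∈ S ] _) (cong (𝟙[ s ∈ S ] *_) (∑-*ˡ (κ g⟨ s ⟩) _)))) ⟩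
      ∑ (λ s → 𝟙[ s ∈ S ] * Φ g⟨ s ⟩)                          ≡⟨ ∑-along-g S Φ ⟩
      ∑ (λ u → fibre S u * Φ u)                                ≡⟨ ∑-cong (λ u → cong (λ x → fibre S u * (κ u * x)) (∑-along-g T (Ψ u))) ⟩
      ∑ (λ u → fibre S u * (κ u * ∑ (λ v → fibre T v * Ψ u v)))
        ≡⟨ ∑-cong (λ u → trans (cong (fibre S u *_) (sym (∑-*ˡ (κ u) _))) (trans (sym (∑-*ˡ (fibre S u) _))
                         (∑-cong (λ v → regroup₂ (fibre S u) (κ u) (fibre T v) (κ v) (χ-bilinear u v))))) ⟩
      ∑ (λ u → ∑ (λ v → (α u * β v) * χ-bilinear u v))         ∎
      where
      open ≡-Reasoning
      Ψ : F → F → ℤ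
      Ψ u v = κ v * χ-bilinear u v
      Φ : F → ℤ
      Φ u = κ u * ∑ (λ t → 𝟙[ t ∈ T ] * Ψ u g⟨ t ⟩)
      regroup₁ : ∀ x y k l m → (x * y) * ((k * l) * m) ≡ x * (k * (y * (l * m)))
      regroup₁ = solve-∀
      regroup₂ : ∀ f k f′ l m → f * (k * (f′ * (l * m))) ≡ ((k * f) * (l * f′)) * m
      regroup₂ = solve-∀

    character-sum-bound : sq (∑∑ S T (λ s t → (κ g⟨ s ⟩ * κ g⟨ t ⟩) * χ-bilinear g⟨ s ⟩ g⟨ t ⟩))
                          ≤ + (2 ℕ.* (d ℕ.* d)) * (+ q * (+ ∣ S ∣ * + ∣ T ∣))
    character-sum-bound = begin
      sq (∑∑ S T (λ s t → (κ g⟨ s ⟩ * κ g⟨ t ⟩) * χ-bilinear g⟨ s ⟩ g⟨ t ⟩))  ≡⟨ cong sq ∑∑-along-g ⟩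
      sq (∑ (λ u → ∑ (λ v → (α u * β v) * χ-bilinear u v)))                   ≤⟨ bilinear-bound α β ⟩
      ∑ (sq ∘ α) * ((+ q + + q) * ∑ (sq ∘ β))
        ≤⟨ *-mono-≤-0≤ (∑-nonneg (sq-nonneg ∘ α)) (*-nonneg {+ q + + q} (+≤+ ℕ.z≤n) (∑-nonneg (sq-nonneg ∘ β)))
                       (∑[κ·fibre]²≤ κ ∣κ∣≤1 S) (*-monoˡ-≤-0≤ (+ q + + q) (+≤+ ℕ.z≤n) (∑[κ·fibre]²≤ κ ∣κ∣≤1 T)) ⟩
      (+ d * + ∣ S ∣) * ((+ q + + q) * (+ d * + ∣ T ∣))                        ≡⟨ regroup (+ d) (+ q) (+ ∣ S ∣) (+ ∣ T ∣) ⟩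
      (+ 2 * (+ d * + d)) * (+ q * (+ ∣ S ∣ * + ∣ T ∣))                        ≡⟨ cong (_* (+ q * (+ ∣ S ∣ * + ∣ T ∣))) (trans (ℤP.pos-* 2 (d ℕ.* d)) (cong (+ 2 *_) (ℤP.pos-* d d))) ⟨
      + (2 ℕ.* (d ℕ.* d)) * (+ q * (+ ∣ S ∣ * + ∣ T ∣))                        ∎
      where
      open ℤP.≤-Reasoning
      regroup : ∀ d q s t → (d * s) * ((q + q) * (d * t)) ≡ (+ 2 * (d * d)) * (q * (s * t))
      regroup = solve-∀

  1≤q : 1 ℕ.≤ q
  1≤q = inhabited 0#
    where
    inhabited : ∀ {n} → Fin n → 1 ℕ.≤ n
    inhabited Fin.zero    = ℕ.s≤s ℕ.z≤n
    inhabited (Fin.suc _) = ℕ.s≤s ℕ.z≤n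

  ∑𝟙≤q : ∀ {P : F → Set} (P? : ∀ x → Dec (P x)) → ∑ (λ x → 𝟙 (P? x)) ≤ + q
  ∑𝟙≤q P? = ℤP.≤-trans (∑-mono (λ x → 𝟙-≤1 (P? x))) (ℤP.≤-reflexive (trans (∑-const 1ℤ) (ℤP.*-identityʳ (+ q))))

  ∑𝟙-root-along-g≤d : ∀ (p : F → F) {r} → (∀ v → p v ≡ 0# → v ≡ r) → ∑ (λ t → 𝟙 (p g⟨ t ⟩ ≟ 0#)) ≤ + d
  ∑𝟙-root-along-g≤d p {r} root≡r = ℤP.≤-trans (∑-mono (λ t → 𝟙-mono (p g⟨ t ⟩ ≟ 0#) (g⟨ t ⟩ ≟ r) (root≡r g⟨ t ⟩)))
                                              (#fibre≤degree g 1≤d deg-g r)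

  ≤q* : ∀ (S T : Subset q) {K} → 0ℤ ≤ K → K * (+ ∣ S ∣ * + ∣ T ∣) ≤ K * (+ q * (+ ∣ S ∣ * + ∣ T ∣))
  ≤q* S T {K} 0≤K = *-monoˡ-≤-0≤ K 0≤K (ℤP.≤-trans (ℤP.≤-reflexive (sym (ℤP.*-identityˡ ST)))
                                                   (*-monoʳ-≤-0≤ ST (*-nonneg {+ ∣ S ∣} {+ ∣ T ∣} (+≤+ ℕ.z≤n) (+≤+ ℕ.z≤n)) (+≤+ 1≤q)))
    where ST = + ∣ S ∣ * + ∣ T ∣

  module _ (S T : Subset q) where

    private
      Q : ℤ
      Q = + q * (+ ∣ S ∣ * + ∣ T ∣)

    zeros-of-g-bound : sq (∑∑ S T (λ s t → 𝟙 (g⟨ s ⟩ ≟ 0#))) ≤ + d * Q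
    zeros-of-g-bound = begin
      sq (∑∑ S T (λ s t → 𝟙 (g⟨ s ⟩ ≟ 0#)))   ≤⟨ ∑∑²≤ S T (λ s t → 𝟙-nonneg (g⟨ s ⟩ ≟ 0#)) (λ s → ∑𝟙≤q (λ _ → g⟨ s ⟩ ≟ 0#))
                                                                                      (λ _ → ∑𝟙-root-along-g≤d (λ v → v) (λ _ v≡0 → v≡0)) ⟩
      (+ ∣ S ∣ * + q) * (+ ∣ T ∣ * + d)       ≡⟨ regroup (+ ∣ S ∣) (+ ∣ T ∣) (+ q) (+ d) ⟩
      + d * Q                                 ∎
      where
      open ℤP.≤-Reasoning
      regroup : ∀ s t q d → (s * q) * (t * d) ≡ d * (q * (s * t))
      regroup = solve-∀

    zeros-of-g-bound′ : sq (∑∑ S T (λ s t → 𝟙 (g⟨ t ⟩ ≟ 0#))) ≤ + d * Q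
    zeros-of-g-bound′ = begin
      sq (∑∑ S T (λ s t → 𝟙 (g⟨ t ⟩ ≟ 0#)))   ≤⟨ ∑∑²≤ S T (λ s t → 𝟙-nonneg (g⟨ t ⟩ ≟ 0#)) (λ _ → ∑𝟙-root-along-g≤d (λ v → v) (λ _ v≡0 → v≡0))
                                                                                      (λ t → ∑𝟙≤q (λ _ → g⟨ t ⟩ ≟ 0#)) ⟩
      (+ ∣ S ∣ * + d) * (+ ∣ T ∣ * + q)       ≡⟨ regroup (+ ∣ S ∣) (+ ∣ T ∣) (+ q) (+ d) ⟩
      + d * Q                                 ∎
      where
      open ℤP.≤-Reasoning
      regroup : ∀ s t q d → (s * d) * (t * q) ≡ d * (q * (s * t))
      regroup = solve-∀

    zeros-of-bilinear-bound : sq (∑∑ S T (λ s t → 𝟙 (bilinear g⟨ s ⟩ g⟨ t ⟩ ≟ 0#))) ≤ + (d ℕ.* d) * Q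
    zeros-of-bilinear-bound = begin
      sq (∑∑ S T (λ s t → 𝟙 (bilinear g⟨ s ⟩ g⟨ t ⟩ ≟ 0#)))
        ≤⟨ ∑∑²≤ S T (λ s t → 𝟙-nonneg (bilinear g⟨ s ⟩ g⟨ t ⟩ ≟ 0#))
                    (λ s → ∑𝟙-root-along-g≤d (bilinear g⟨ s ⟩) (proj₂ (unique-root-v g⟨ s ⟩)))
                    (λ t → ∑𝟙-root-along-g≤d (λ u → bilinear u g⟨ t ⟩) (proj₂ (unique-root-u g⟨ t ⟩))) ⟩
      (+ ∣ S ∣ * + d) * (+ ∣ T ∣ * + d)        ≡⟨ trans (regroup (+ ∣ S ∣) (+ ∣ T ∣) (+ d)) (cong (_* (+ ∣ S ∣ * + ∣ T ∣)) (sym (ℤP.pos-* d d))) ⟩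
      + (d ℕ.* d) * (+ ∣ S ∣ * + ∣ T ∣)        ≤⟨ ≤q* S T {+ (d ℕ.* d)} (+≤+ ℕ.z≤n) ⟩
      + (d ℕ.* d) * Q                         ∎
      where
      open ℤP.≤-Reasoning
      regroup : ∀ s t d → (s * d) * (t * d) ≡ (d * d) * (s * t)
      regroup = solve-∀

    diagonal-bound : ∀ {y} → (∀ s t → 0ℤ ≤ y s t) → (∀ s t → y s t ≤ + 2 * 𝟙 (s ≟ t)) → sq (∑∑ S T y) ≤ + 4 * Q
    diagonal-bound {y} 0≤y y≤2δ = begin
      sq (∑∑ S T y)                        ≤⟨ ∑∑²≤ S T 0≤y (λ s → rows s) (λ t → columns t) ⟩
      (+ ∣ S ∣ * + 2) * (+ ∣ T ∣ * + 2)     ≡⟨ regroup (+ ∣ S ∣) (+ ∣ T ∣) ⟩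
      + 4 * (+ ∣ S ∣ * + ∣ T ∣)            ≤⟨ ≤q* S T {+ 4} (+≤+ ℕ.z≤n) ⟩
      + 4 * Q                              ∎
      where
      open ℤP.≤-Reasoning
      regroup : ∀ s t → (s * + 2) * (t * + 2) ≡ + 4 * (s * t)
      regroup = solve-∀
      rows : ∀ s → ∑ (y s) ≤ + 2
      rows s = ℤP.≤-trans (∑-mono (y≤2δ s)) (ℤP.≤-reflexive (trans (∑-*ˡ (+ 2) _) (cong (+ 2 *_) (trans (∑-cong (λ t → 𝟙-cong (s ≟ t) (t ≟ s) sym sym)) (∑-𝟙≡ s)))))
      columns : ∀ t → ∑ (λ s → y s t) ≤ + 2
      columns t = ℤP.≤-trans (∑-mono (λ s → y≤2δ s t)) (ℤP.≤-reflexive (trans (∑-*ˡ (+ 2) _) (cong (+ 2 *_) (∑-𝟙≡ t))))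

  -- X_h is the case κ = 1, X_h̃ the case κ = χ.
  module GraphDiscrepancy (w : F → F → F)
    (κ : F → ℤ) (∣κ∣≤1 : ∀ u → ℤ.∣ κ u ∣ ℕ.≤ 1)
    (χ∘w : ∀ s t → χ (w s t) ≡ (κ g⟨ s ⟩ * κ g⟨ t ⟩) * χ-bilinear g⟨ s ⟩ g⟨ t ⟩)
    (zeros-of-w : ∀ s t → w s t ≡ 0# → g⟨ s ⟩ ≡ 0# ⊎ g⟨ t ⟩ ≡ 0# ⊎ bilinear g⟨ s ⟩ g⟨ t ⟩ ≡ 0#) where

    open Graph 𝔽 w using (adjacent?; e)

    adjacency : F → F → ℤ
    adjacency s t = 𝟙 (T? (adjacent? s t))

    zero-of-w : F → F → ℤ
    zero-of-w s t = 𝟙 (w s t ≟ 0#)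

    diagonal : F → F → ℤ
    diagonal s t = 𝟙 (s ≟ t) * ((χ (w s t) + zero-of-w s t) + 1ℤ)

    2·adjacency-1 : ∀ s t → + 2 * adjacency s t - 1ℤ ≡ (χ (w s t) + zero-of-w s t) - diagonal s t
    2·adjacency-1 s t with s ≟ t
    ... | yes _ = minus-one (χ (w s t)) (zero-of-w s t)
      where
      minus-one : ∀ x z → + 2 * 0ℤ - 1ℤ ≡ (x + z) - 1ℤ * ((x + z) + 1ℤ)
      minus-one = solve-∀
    ... | no _ = begin
      + 2 * 𝟙 (T? (does (isSquare? (w s t)))) - 1ℤ            ≡⟨ cong (λ i → + 2 * i - 1ℤ) (𝟙-T?-does (isSquare? (w s t))) ⟩
      + 2 * 𝟙 (isSquare? (w s t)) - 1ℤ                        ≡⟨ 2·𝟙square-1≡χ+𝟙zero (w s t) ⟩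
      χ (w s t) + zero-of-w s t                               ≡⟨ minus-zero (χ (w s t) + zero-of-w s t) ⟩
      (χ (w s t) + zero-of-w s t) - 0ℤ * ((χ (w s t) + zero-of-w s t) + 1ℤ) ∎
      where
      open ≡-Reasoning
      minus-zero : ∀ x → x ≡ x - 0ℤ * (x + 1ℤ)
      minus-zero = solve-∀

    diagonal≡ : ∀ s t → diagonal s t ≡ 𝟙 (s ≟ t) * (+ 2 * 𝟙 (isSquare? (w s t)))
    diagonal≡ s t = cong (𝟙 (s ≟ t) *_) (begin
      (χ (w s t) + zero-of-w s t) + 1ℤ                 ≡⟨ cong (_+ 1ℤ) (2·𝟙square-1≡χ+𝟙zero (w s t)) ⟨
      (+ 2 * 𝟙 (isSquare? (w s t)) - 1ℤ) + 1ℤ           ≡⟨ minus-plus (+ 2 * 𝟙 (isSquare? (w s t))) ⟩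
      + 2 * 𝟙 (isSquare? (w s t))                      ∎)
      where
      open ≡-Reasoning
      minus-plus : ∀ x → (x - 1ℤ) + 1ℤ ≡ x
      minus-plus = solve-∀

    diagonal-nonneg : ∀ s t → 0ℤ ≤ diagonal s t
    diagonal-nonneg s t = subst (0ℤ ≤_) (sym (diagonal≡ s t))
      (*-nonneg (𝟙-nonneg (s ≟ t)) (*-nonneg {+ 2} (+≤+ ℕ.z≤n) (𝟙-nonneg (isSquare? (w s t)))))

    diagonal≤2δ : ∀ s t → diagonal s t ≤ + 2 * 𝟙 (s ≟ t)
    diagonal≤2δ s t = begin
      diagonal s t                                    ≡⟨ diagonal≡ s t ⟩
      𝟙 (s ≟ t) * (+ 2 * 𝟙 (isSquare? (w s t)))       ≤⟨ *-monoˡ-≤-0≤ (𝟙 (s ≟ t)) (𝟙-nonneg (s ≟ t)) (*-monoˡ-≤-0≤ (+ 2) (+≤+ ℕ.z≤n) (𝟙-≤1 (isSquare? (w s t)))) ⟩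
      𝟙 (s ≟ t) * (+ 2 * 1ℤ)                          ≡⟨ ℤP.*-comm (𝟙 (s ≟ t)) (+ 2) ⟩
      + 2 * 𝟙 (s ≟ t)                                 ∎
      where open ℤP.≤-Reasoning

    module _ (S T : Subset q) where

      open Pairs S T using (weight; ∑∑-cong; ∑∑-+; ∑∑-sub; ∑∑-*ˡ; ∑∑-1; ∑∑-mono; ∑∑-nonneg)

      edges≡∑∑ : + e S T ≡ ∑∑ S T adjacency
      edges≡∑∑ = trans (#pairs _) (∑-cong (λ s → ∑-cong (λ t → begin
        𝟙 ((s ∈? S) ×-dec ((t ∈? T) ×-dec T? (adjacent? s t)))   ≡⟨ 𝟙-×-dec (s ∈? S) _ ⟩
        𝟙[ s ∈ S ] * 𝟙 ((t ∈? T) ×-dec T? (adjacent? s t))        ≡⟨ cong (𝟙[ s ∈ S ] *_) (𝟙-×-dec (t ∈? T) _) ⟩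
        𝟙[ s ∈ S ] * (𝟙[ t ∈ T ] * adjacency s t)                ≡⟨ ℤP.*-assoc 𝟙[ s ∈ S ] 𝟙[ t ∈ T ] (adjacency s t) ⟨
        weight s t * adjacency s t                              ∎)))
        where open ≡-Reasoning

      character-part zero-part diagonal-part : ℤ
      character-part = ∑∑ S T (λ s t → χ (w s t))
      zero-part      = ∑∑ S T zero-of-w
      diagonal-part  = ∑∑ S T diagonal

      decomposition : + (2 ℕ.* e S T) - + ∣ S ∣ * + ∣ T ∣ ≡ character-part + zero-part - diagonal-part
      decomposition = begin
        + (2 ℕ.* e S T) - + ∣ S ∣ * + ∣ T ∣                          ≡⟨ cong₂ _-_ (trans (ℤP.pos-* 2 (e S T)) (cong (+ 2 *_) edges≡∑∑)) (sym ∑∑-1) ⟩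
        + 2 * ∑∑ S T adjacency - ∑∑ S T (λ _ _ → 1ℤ)                          ≡⟨ cong (_- ∑∑ S T (λ _ _ → 1ℤ)) (∑∑-*ˡ (+ 2) adjacency) ⟨
        ∑∑ S T (λ s t → + 2 * adjacency s t) - ∑∑ S T (λ _ _ → 1ℤ)            ≡⟨ ∑∑-sub _ _ ⟨
        ∑∑ S T (λ s t → + 2 * adjacency s t - 1ℤ)                         ≡⟨ ∑∑-cong 2·adjacency-1 ⟩
        ∑∑ S T (λ s t → (χ (w s t) + zero-of-w s t) - diagonal s t)       ≡⟨ ∑∑-sub _ _ ⟩
        ∑∑ S T (λ s t → χ (w s t) + zero-of-w s t) - diagonal-part        ≡⟨ cong (_- diagonal-part) (∑∑-+ _ _) ⟩
        character-part + zero-part - diagonal-part                    ∎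
        where open ≡-Reasoning

      private
        Q : ℤ
        Q = + q * (+ ∣ S ∣ * + ∣ T ∣)

      character-part-bound : sq character-part ≤ + (2 ℕ.* (d ℕ.* d)) * Q
      character-part-bound = subst (λ x → sq x ≤ + (2 ℕ.* (d ℕ.* d)) * Q) (sym (∑∑-cong χ∘w)) (character-sum-bound κ ∣κ∣≤1 S T)

      zero-part-bound : sq zero-part ≤ + (3 ℕ.* (d ℕ.+ d ℕ.+ d ℕ.* d)) * Q
      zero-part-bound = ℤP.≤-trans (sq≤* (∑∑-nonneg (λ s t → 𝟙-nonneg (w s t ≟ 0#))) zero-part≤ zero-part≤)
        (sq-+₃≤-multiples zeros-of-g zeros-of-g′ zeros-of-bilinear d d (d ℕ.* d) (zeros-of-g-bound S T) (zeros-of-g-bound′ S T) (zeros-of-bilinear-bound S T))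
        where
        zeros-of-g zeros-of-g′ zeros-of-bilinear : ℤ
        zeros-of-g        = ∑∑ S T (λ s t → 𝟙 (g⟨ s ⟩ ≟ 0#))
        zeros-of-g′       = ∑∑ S T (λ s t → 𝟙 (g⟨ t ⟩ ≟ 0#))
        zeros-of-bilinear = ∑∑ S T (λ s t → 𝟙 (bilinear g⟨ s ⟩ g⟨ t ⟩ ≟ 0#))
        zero-part≤ : zero-part ≤ zeros-of-g + zeros-of-g′ + zeros-of-bilinear
        zero-part≤ = ℤP.≤-trans
          (∑∑-mono (λ s t → 𝟙-⊎₃ (w s t ≟ 0#) (g⟨ s ⟩ ≟ 0#) (g⟨ t ⟩ ≟ 0#) (bilinear g⟨ s ⟩ g⟨ t ⟩ ≟ 0#) (zeros-of-w s t)))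
          (ℤP.≤-reflexive (trans (∑∑-+ _ _) (cong (_+ zeros-of-bilinear) (∑∑-+ _ _))))

      diagonal-part-bound : sq (- diagonal-part) ≤ + 4 * Q
      diagonal-part-bound = subst (_≤ + 4 * Q) (sym (sq-neg diagonal-part)) (diagonal-bound S T diagonal-nonneg diagonal≤2δ)

      discrepancy-bound : sq (+ (2 ℕ.* e S T) - + ∣ S ∣ * + ∣ T ∣) ≤ + (3 ℕ.* (2 ℕ.* (d ℕ.* d) ℕ.+ 3 ℕ.* (d ℕ.+ d ℕ.+ d ℕ.* d) ℕ.+ 4)) * Q
      discrepancy-bound = subst (λ x → sq x ≤ + (3 ℕ.* (2 ℕ.* (d ℕ.* d) ℕ.+ 3 ℕ.* (d ℕ.+ d ℕ.+ d ℕ.* d) ℕ.+ 4)) * Q) (sym decomposition)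
        (sq-+₃≤-multiples character-part zero-part (- diagonal-part) (2 ℕ.* (d ℕ.* d)) (3 ℕ.* (d ℕ.+ d ℕ.+ d ℕ.* d)) 4 character-part-bound zero-part-bound diagonal-part-bound)

module HFamily {q : ℕ} (𝔽 : FiniteField q) (q-odd : q ℕ.% 2 ≡ 1)
  (f : FF.Poly2 𝔽) (admissible : FF.Admissible 𝔽 f) (degX : FF.DegX1 𝔽 f) (degY : FF.DegY1 𝔽 f)
  (g : FF.Poly 𝔽) {d : ℕ} (1≤d : 1 ℕ.≤ d) (deg-g : FF.HasDegree 𝔽 g d) where

  open import Data.Integer as ℤ using (1ℤ)
  import Data.Integer.Properties as ℤP
  open import Data.Sum as Sum using (_⊎_; inj₁; inj₂)
  open import Relation.Binary.PropositionalEquality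
  open CharacterSums 𝔽 q-odd
  open Polynomials 𝔽 using (evalP2-bidegree11)
  open Admissibility 𝔽 using (module Bidegree11)
  open Bidegree11 f degX degY using (a; b; c; e; admissible⇒ae≢bc)

  form : Nondegenerate
  form = record { a = a ; b = b ; c = c ; e = e ; Δ≢0 = admissible⇒ae≢bc admissible }

  open BilinearCharacter form using (bilinear)
  open Discrepancy 𝔽 q-odd form g 1≤d deg-g using (g⟨_⟩; module GraphDiscrepancy)

  f≡bilinear : ∀ s t → FF.evalP2 𝔽 f g⟨ s ⟩ g⟨ t ⟩ ≡ bilinear g⟨ s ⟩ g⟨ t ⟩
  f≡bilinear s t = evalP2-bidegree11 f degX degY g⟨ s ⟩ g⟨ t ⟩

  module H = GraphDiscrepancy (hFun 𝔽 f g) (λ _ → 1ℤ) (λ _ → ℕ.s≤s ℕ.z≤n)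
    (λ s t → trans (cong χ (f≡bilinear s t)) (sym (ℤP.*-identityˡ _)))
    (λ s t h≡0 → inj₂ (inj₂ (trans (sym (f≡bilinear s t)) h≡0)))

  zeros-of-h̃ : ∀ s t → h~Fun 𝔽 f g s t ≡ 0# → g⟨ s ⟩ ≡ 0# ⊎ g⟨ t ⟩ ≡ 0# ⊎ bilinear g⟨ s ⟩ g⟨ t ⟩ ≡ 0#
  zeros-of-h̃ s t h̃≡0 with x*y≡0⇒x≡0∨y≡0 (g⟨ s ⟩ * g⟨ t ⟩) (FF.evalP2 𝔽 f g⟨ s ⟩ g⟨ t ⟩) h̃≡0
  ... | inj₂ f≡0  = inj₂ (inj₂ (trans (sym (f≡bilinear s t)) f≡0))
  ... | inj₁ gg≡0 = Sum.map₂ inj₁ (x*y≡0⇒x≡0∨y≡0 g⟨ s ⟩ g⟨ t ⟩ gg≡0)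

  module H̃ = GraphDiscrepancy (h~Fun 𝔽 f g) χ ∣χ∣≤1
    (λ s t → trans (cong (λ x → χ ((g⟨ s ⟩ * g⟨ t ⟩) * x)) (f≡bilinear s t))
                   (trans (χ-* (g⟨ s ⟩ * g⟨ t ⟩) (bilinear g⟨ s ⟩ g⟨ t ⟩)) (cong (ℤ._* χ (bilinear g⟨ s ⟩ g⟨ t ⟩)) (χ-* g⟨ s ⟩ g⟨ t ⟩))))
    zeros-of-h̃

open import Data.Nat using (ℕ; _≤_; _<_; _*_; _^_; _%_; ∣_-_∣)
import Data.Nat.Properties as ℕP
open import Data.Fin.Subset using (Subset; ∣_∣)
open import Data.Product using (∃; _×_; _,_)
open import Relation.Binary.PropositionalEquality using (_≡_)
open IntegerSums using (integer-bound⇒ℕ)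

constant : ℕ → ℕ
constant d = 3 ℕ.* (2 ℕ.* (d ℕ.* d) ℕ.+ 3 ℕ.* (d ℕ.+ d ℕ.+ d ℕ.* d) ℕ.+ 4)

0<constant : ∀ d → 0 ℕ.< constant d
0<constant d = ℕP.<-≤-trans (ℕ.s≤s ℕ.z≤n) (ℕP.≤-trans (ℕP.m≤n+m 4 x) (ℕP.m≤n*m (x ℕ.+ 4) 3))
  where x = 2 ℕ.* (d ℕ.* d) ℕ.+ 3 ℕ.* (d ℕ.+ d ℕ.+ d ℕ.* d)

theorem1p5 : (d : ℕ) → 1 ≤ d →
    ∃ λ C → 0 < C ×
      ((q : ℕ) → q % 2 ≡ 1 → (𝔽 : FiniteField q) →
       (f : FF.Poly2 𝔽) → FF.Admissible 𝔽 f → FF.DegX1 𝔽 f → FF.DegY1 𝔽 f →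
       (g : FF.Poly 𝔽) → FF.HasDegree 𝔽 g d →
       (S T : Subset q) →
         (∣ 2 * Graph.e 𝔽 (hFun 𝔽 f g) S T - ∣ S ∣ * ∣ T ∣ ∣ ^ 2
            ≤ C * q * ∣ S ∣ * ∣ T ∣)
         × (∣ 2 * Graph.e 𝔽 (h~Fun 𝔽 f g) S T - ∣ S ∣ * ∣ T ∣ ∣ ^ 2
            ≤ C * q * ∣ S ∣ * ∣ T ∣))
theorem1p5 d 1≤d = constant d , 0<constant d , λ q q-odd 𝔽 f admissible degX degY g deg-g S T →
  let open HFamily 𝔽 q-odd f admissible degX degY g 1≤d deg-g in
  integer-bound⇒ℕ _ (∣ S ∣) (∣ T ∣) (constant d) q (H.discrepancy-bound S T) ,
  integer-bound⇒ℕ _ (∣ S ∣) (∣ T ∣) (constant d) q (H̃.discrepancy-bound S T)
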